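{- Let $q$ be a prime power, $1\le t\le\ell\le m$ integers, and let $f(X)=\sum_{i=1}^\ell\sum_{j=1}^m f_{ij}X_{ij}\in\mathbb{F}_q[X]_1$ with coefficient matrix $F=(f_{ij})$. Then the Hamming weights of the corresponding codewords $c_f\in C_{\det}(t;\ell,m)$ and $\hat c_f\in\hat C_{\det}(t;\ell,m)$ depend only on $\mathrm{rk}(F)$. In fact, if $r=\mathrm{rk}(F)$, then $w_H(c_f)=w_H(c_{\tau_r})$ and $w_H(\hat c_f)=w_H(\hat c_{\tau_r})$, where $\tau_r:=X_{11}+\cdots+X_{rr}$ is the $r$-th partial trace of $X$.
   Context: $\mathbb{F}_q$ is the finite field with $q$ elements; $X=(X_{ij})$ is an $\ell\times m$ matrix of indeterminates; $\mathbb{F}_q[X]_1$ is the space of linear homogeneous polynomials in the $X_{ij}$ (with $0$), evaluated at $M\in M_{\ell\times m}(\mathbb{F}_q)$ by $f(M)=\sum f_{ij}M_{ij}$. Let $M_1,\dots,M_n$ be an ordering of all $M\in M_{\ell\times m}(\mathbb{F}_q)$ with $\mathrm{rk}(M)\le t$, and $c_f=(f(M_1),\dots,f(M_n))$; $C_{\det}(t;\ell,m)=\{c_f\}$. Let $\hat M_1,\dots,\hat M_{\hat n}$ be representatives, one from each class of nonzero scalar multiples, of the nonzero matrices of rank $\le t$, and $\hat c_f=(f(\hat M_1),\dots,f(\hat M_{\hat n}))$; $\hat C_{\det}(t;\ell,m)=\{\hat c_f\}$. $w_H(c)$ denotes the number of nonzero coordinates of $c$. -}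

module Defs where

open import Level using (0ℓ)
open import Data.Nat using (ℕ; zero; suc; _<_; _≤_; _<?_)
open import Data.Fin using (Fin; toℕ) renaming (zero to fzero; suc to fsuc)
open import Data.Vec using (Vec; []; _∷_; lookup; tabulate; map; zipWith; replicate; foldr)
open import Data.List using (List; length; filter)
open import Data.List.Membership.Propositional using (_∈_)
open import Data.List.Relation.Unary.Unique.Propositional using (Unique)
open import Data.List.Relation.Unary.All using (All)
open import Data.List.Relation.Unary.AllPairs using (AllPairs)
open import Data.Product using (Σ; ∃; _×_; _,_)
open import Relation.Binary.PropositionalEquality using (_≡_; _≢_)
open import Relation.Binary.Definitions using (DecidableEquality)
open import Relation.Nullary using (¬_; Dec; yes; no)
open import Relation.Nullary.Decidable using (¬?)
open import Relation.Nullary.Decidable using (_×-dec_)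
open import Algebra.Structures using (IsCommutativeRing)

record FiniteField : Set₁ where
  infixl 6 _+_
  infixl 7 _*_
  field
    Carrier  : Set
    _+_ _*_  : Carrier → Carrier → Carrier
    -_       : Carrier → Carrier
    0# 1#    : Carrier
    isCommutativeRing : IsCommutativeRing _≡_ _+_ _*_ -_ 0# 1#
    0≢1      : 0# ≢ 1#
    inverse  : ∀ x → x ≢ 0# → ∃ λ y → x * y ≡ 1#
    _≟_      : DecidableEquality Carrier
    elements : List Carrier
    elements-unique   : Unique elements
    elements-complete : ∀ x → x ∈ elements

module _ (K : FiniteField) where
  open FiniteField K

  order : ℕ
  order = length elements

  Mat : ℕ → ℕ → Set
  Mat ℓ m = Vec (Vec Carrier m) ℓ

  entry : ∀ {ℓ m} → Mat ℓ m → Fin ℓ → Fin m → Carrier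
  entry M i j = lookup (lookup M i) j

  zeroVec : ∀ {m} → Vec Carrier m
  zeroVec = replicate _ 0#

  zeroMat : ∀ {ℓ m} → Mat ℓ m
  zeroMat = replicate _ zeroVec

  _·ᵥ_ : ∀ {m} → Carrier → Vec Carrier m → Vec Carrier m
  c ·ᵥ v = map (c *_) v

  _+ᵥ_ : ∀ {m} → Vec Carrier m → Vec Carrier m → Vec Carrier m
  u +ᵥ v = zipWith _+_ u v

  _·ₘ_ : ∀ {ℓ m} → Carrier → Mat ℓ m → Mat ℓ m
  c ·ₘ M = map (c ·ᵥ_) M

  sumK : ∀ {n} → Vec Carrier n → Carrier
  sumK = foldr _ _+_ 0#

  linComb : ∀ {k m} → (Fin k → Carrier) → (Fin k → Vec Carrier m) → Vec Carrier m
  linComb {zero}  c v = zeroVec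
  linComb {suc k} c v = (c fzero ·ᵥ v fzero) +ᵥ linComb (λ i → c (fsuc i)) (λ i → v (fsuc i))

  LinIndep : ∀ {k m} → (Fin k → Vec Carrier m) → Set
  LinIndep {k} v = ∀ (c : Fin k → Carrier) → linComb c v ≡ zeroVec → ∀ i → c i ≡ 0#

  HasRank : ∀ {ℓ m} → Mat ℓ m → ℕ → Set
  HasRank {ℓ} M r =
    (∃ λ (s : Fin r → Fin ℓ) → LinIndep (λ i → lookup M (s i)))
    × (∀ (s : Fin (suc r) → Fin ℓ) → ¬ LinIndep (λ i → lookup M (s i)))

  RankLE : ∀ {ℓ m} → Mat ℓ m → ℕ → Set
  RankLE M t = ∃ λ r → HasRank M r × r ≤ t

  -- a linear form f = Σ f_ij X_ij is given by its coefficient matrix F;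
  -- evaluation f(M) = Σ_ij f_ij M_ij
  evalLin : ∀ {ℓ m} → Mat ℓ m → Mat ℓ m → Carrier
  evalLin F M = sumK (zipWith (λ u v → sumK (zipWith _*_ u v)) F M)

  partialTrace : ∀ {ℓ m} → ℕ → Mat ℓ m
  partialTrace r = tabulate λ i → tabulate λ j → diag (toℕ i) (toℕ j)
    where
      diag : ℕ → ℕ → Carrier
      diag a b with (a Data.Nat.≟ b) ×-dec (a <? r)
      ... | yes _ = 1#
      ... | no  _ = 0#

  -- Ms is an ordering M_1,…,M_n of all matrices of rank ≤ t
  IsRankEnum : ∀ {ℓ m} → ℕ → List (Mat ℓ m) → Set
  IsRankEnum t Ms = Unique Ms × All (λ M → RankLE M t) Ms
                    × (∀ M → RankLE M t → M ∈ Ms)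

  -- Ms is a list of representatives, one from each class of nonzero scalar
  -- multiples, of the nonzero matrices of rank ≤ t
  ScalarMultiple : ∀ {ℓ m} → Mat ℓ m → Mat ℓ m → Set
  ScalarMultiple M N = ∃ λ c → M ≡ c ·ₘ N

  IsProjRankEnum : ∀ {ℓ m} → ℕ → List (Mat ℓ m) → Set
  IsProjRankEnum t Ms =
    All (λ M → M ≢ zeroMat × RankLE M t) Ms
    × AllPairs (λ M N → ¬ ScalarMultiple M N) Ms
    × (∀ M → M ≢ zeroMat → RankLE M t → ∃ λ N → N ∈ Ms × ScalarMultiple M N)

  -- Hamming weight of the codeword c_f = (f(M_1),…,f(M_n))
  weight : ∀ {ℓ m} → Mat ℓ m → List (Mat ℓ m) → ℕ
  weight F Ms = length (filter (λ M → ¬? (evalLin F M ≟ 0#)) Ms)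

module Submission where

-- Identify the linear form f with its coefficient matrix F, so that
-- f(M) = ⟨F , M⟩ = Σᵢⱼ Fᵢⱼ Mᵢⱼ.  Elementary row and column operations E are
-- invertible, commute with scalars, preserve the rank, and have an adjoint
-- E* of the same kind with ⟨E G , N⟩ = ⟨G , E* N⟩.  Gaussian elimination
-- turns F into a partial trace τ_r' by such operations, and rank invariance
-- forces r' = rk F = r.  Composing the adjoints gives a rank-preserving,
-- scalar-compatible injection Φ on matrices with ⟨F , Φ N⟩ = ⟨τ_r , N⟩ and,
-- using the inverses, one Ψ with ⟨τ_r , Ψ N⟩ = ⟨F , N⟩.  Such a map sends the
-- matrices of rank ≤ t on which one form is nonzero injectively (and also on
-- classes of scalar multiples) to those on which the other form is nonzero,
-- so a pigeonhole count gives both inequalities between the weights.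

open import Defs
open import Level using (0ℓ)
open import Data.Nat as ℕ using (ℕ; zero; suc; _<_; _≤_; _<?_; z≤n; s≤s)
import Data.Nat.Properties as ℕₚ
open import Data.Fin as Fin using (Fin; toℕ) renaming (zero to fzero; suc to fsuc)
open import Data.Fin.Properties
  using (toℕ-injective; suc-injective; 0≢1+n; any?; all?; toℕ-inject≤; toℕ-fromℕ<; toℕ<n; <⇒≢; pigeonhole)
  renaming (_≟_ to _≟ᶠ_)
open import Data.Vec as Vec using (Vec; []; _∷_; lookup; tabulate)
import Data.Vec.Properties as Vecₚ
open import Data.Vec.Functional using (Vector; updateAt; head; tail) renaming (_∷_ to _∷ᶠ_)
open import Data.Vec.Functional.Properties using (updateAt-updates; updateAt-minimal)
open import Data.List as List using (List; []; _∷_; length; filter; _++_)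
open import Data.List.Properties using (length-removeAt′)
open import Data.List.Relation.Unary.Any as Any using (here; there; _─_)
import Data.List.Relation.Unary.All as All
open import Data.List.Relation.Unary.AllPairs using (AllPairs; []; _∷_)
import Data.List.Relation.Unary.AllPairs.Properties as AllPairsₚ
open import Data.List.Relation.Unary.Unique.Propositional.Properties using (allFin⁺)
open import Data.List.Membership.Propositional using (_∈_; lose)
open import Data.List.Membership.Propositional.Properties using (∈-allFin; ∈-filter⁺; ∈-filter⁻)
open import Data.Product using (∃; _×_; _,_; proj₁; proj₂)
open import Data.Sum using (_⊎_; inj₁; inj₂; [_,_]′)
open import Data.Empty using (⊥-elim)
open import Relation.Nullary using (¬_; Dec; yes; no)
open import Relation.Nullary.Decidable using (¬?; _×-dec_; decidable-stable)
open import Relation.Binary.PropositionalEquality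
open import Relation.Binary.Definitions using (tri<; tri≈; tri>)
open import Algebra.Bundles using (CommutativeRing)
open import Function.Base using (_∘_; _∋_)
import Algebra.Properties.Ring as RingProperties
import Algebra.Properties.CommutativeSemigroup as CSemigroupProperties
import Algebra.Properties.Semiring.Sum as SumProperties

∈-─ : ∀ {A : Set} {y y′ : A} (ys : List A) (y∈ys : y ∈ ys) → y′ ∈ ys → y′ ≡ y ⊎ y′ ∈ (ys ─ y∈ys)
∈-─ (_ ∷ ys) (here refl)  (here refl)   = inj₁ refl
∈-─ (_ ∷ ys) (here refl)  (there y′∈ys) = inj₂ y′∈ys
∈-─ (_ ∷ ys) (there y∈ys) (here refl)   = inj₂ (here refl)
∈-─ (_ ∷ ys) (there y∈ys) (there y′∈ys) with ∈-─ ys y∈ys y′∈ys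
... | inj₁ y′≡y   = inj₁ y′≡y
... | inj₂ y′∈ys─ = inj₂ (there y′∈ys─)

length-≤-by-relation : ∀ {A B : Set} (R : A → B → Set) (E : A → A → Set) →
  (∀ {x x′ y} → R x y → R x′ y → E x x′) → (xs : List A) (ys : List B) →
  AllPairs (λ x x′ → ¬ E x x′) xs → (∀ {x} → x ∈ xs → ∃ λ y → y ∈ ys × R x y) →
  length xs ≤ length ys
length-≤-by-relation R E R-unique []       ys _                 related = z≤n
length-≤-by-relation R E R-unique (x ∷ xs) ys (x≁xs ∷ distinct) related =
  let y , y∈ys , Rxy = related (here refl)
  in  subst (suc (length xs) ≤_) (sym (length-removeAt′ ys (Any.index y∈ys)))
        (s≤s (length-≤-by-relation R E R-unique xs (ys ─ y∈ys) distinct (related-rest y∈ys Rxy)))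
  where
    related-rest : ∀ {y} (y∈ys : y ∈ ys) → R x y →
                   ∀ {x′} → x′ ∈ xs → ∃ λ y′ → y′ ∈ (ys ─ y∈ys) × R x′ y′
    related-rest y∈ys Rxy x′∈xs with related (there x′∈xs)
    ... | y′ , y′∈ys , Rx′y′ with ∈-─ ys y∈ys y′∈ys
    ...   | inj₁ refl    = ⊥-elim (All.lookup x≁xs x′∈xs (R-unique Rxy Rx′y′))
    ...   | inj₂ y′∈ys─ = y′ , y′∈ys─ , Rx′y′

module _ (K : FiniteField) where
  open FiniteField K
  open ≡-Reasoning

  ring : CommutativeRing 0ℓ 0ℓ
  ring = record { isCommutativeRing = isCommutativeRing }

  open CommutativeRing ring using
    ( +-assoc; +-identityˡ; +-identityʳ; -‿inverseˡ; -‿inverseʳ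
    ; *-comm; *-assoc; *-identityˡ; *-identityʳ; zeroˡ; zeroʳ; distribˡ; distribʳ )
  open RingProperties (CommutativeRing.ring ring)
    using (-‿involutive; -0#≈0#; +-inverseʳ-unique; -1*x≈-x; -‿distribˡ-*; -‿distribʳ-*)
  open CSemigroupProperties (CommutativeRing.+-commutativeSemigroup ring) using (interchange)
  open CSemigroupProperties (CommutativeRing.*-commutativeSemigroup ring) using (x∙yz≈y∙xz)
  open SumProperties (CommutativeRing.semiring ring)
    using (sum; sum-cong-≗; sum-replicate-zero; ∑-distrib-+; ∑-comm; *-distribˡ-sum; *-distribʳ-sum)

  1≢0 : 1# ≢ 0#
  1≢0 e = 0≢1 (sym e)

  inv : ∀ c → c ≢ 0# → Carrier
  inv c c≢0 = proj₁ (inverse c c≢0)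

  inv-r : ∀ c (c≢0 : c ≢ 0#) → c * inv c c≢0 ≡ 1#
  inv-r c c≢0 = proj₂ (inverse c c≢0)

  inv-l : ∀ c (c≢0 : c ≢ 0#) → inv c c≢0 * c ≡ 1#
  inv-l c c≢0 = trans (*-comm _ c) (inv-r c c≢0)

  inv≢0 : ∀ c (c≢0 : c ≢ 0#) → inv c c≢0 ≢ 0#
  inv≢0 c c≢0 e = 1≢0 (trans (sym (inv-r c c≢0)) (trans (cong (c *_) e) (zeroʳ c)))

  cancel-nonzero : ∀ x y → x * y ≡ 0# → y ≢ 0# → x ≡ 0#
  cancel-nonzero x y xy≡0 y≢0 = begin
    x                       ≡⟨ sym (*-identityʳ x) ⟩
    x * 1#                  ≡⟨ cong (x *_) (sym (inv-r y y≢0)) ⟩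
    x * (y * inv y y≢0)     ≡⟨ sym (*-assoc x y _) ⟩
    (x * y) * inv y y≢0     ≡⟨ cong (_* inv y y≢0) xy≡0 ⟩
    0# * inv y y≢0          ≡⟨ zeroˡ _ ⟩
    0#                      ∎

  *≢0 : ∀ x y → x ≢ 0# → y ≢ 0# → x * y ≢ 0#
  *≢0 x y x≢0 y≢0 e = x≢0 (cancel-nonzero x y e y≢0)

  -≢0 : ∀ x → x ≢ 0# → - x ≢ 0#
  -≢0 x x≢0 e = x≢0 (trans (sym (-‿involutive x)) (trans (cong -_ e) -0#≈0#))

  sum-zero : ∀ {k} (f : Fin k → Carrier) → (∀ i → f i ≡ 0#) → sum f ≡ 0#
  sum-zero {k} f f≡0 = trans (sum-cong-≗ f≡0) (sum-replicate-zero k)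

  sum-single : ∀ {k} (f : Fin k → Carrier) i → (∀ j → j ≢ i → f j ≡ 0#) → sum f ≡ f i
  sum-single f fzero     f≡0 =
    trans (cong (f fzero +_) (sum-zero (tail f) (λ j → f≡0 (fsuc j) λ ()))) (+-identityʳ _)
  sum-single f (fsuc i) f≡0 =
    trans (cong₂ _+_ (f≡0 fzero λ ()) (sum-single (tail f) i (λ j j≢i → f≡0 (fsuc j) (j≢i ∘ suc-injective))))
          (+-identityˡ _)

  sum-nonzero : ∀ {k} (f : Fin k → Carrier) → sum f ≢ 0# → ∃ λ i → f i ≢ 0#
  sum-nonzero {zero}  f Σf≢0 = ⊥-elim (Σf≢0 refl)
  sum-nonzero {suc k} f Σf≢0 with f fzero ≟ 0#
  ... | no f0≢0 = fzero , f0≢0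
  ... | yes f0≡0 =
    let i , fi≢0 = sum-nonzero (tail f) (λ e → Σf≢0 (trans (cong₂ _+_ f0≡0 e) (+-identityʳ 0#)))
    in fsuc i , fi≢0

  δ : ∀ {k} → Fin k → Fin k → Carrier
  δ i j with j ≟ᶠ i
  ... | yes _ = 1#
  ... | no  _ = 0#

  δ-same : ∀ {k} (i : Fin k) → δ i i ≡ 1#
  δ-same i with i ≟ᶠ i
  ... | yes _   = refl
  ... | no  i≢i = ⊥-elim (i≢i refl)

  δ-other : ∀ {k} (i j : Fin k) → j ≢ i → δ i j ≡ 0#
  δ-other i j j≢i with j ≟ᶠ i
  ... | yes j≡i = ⊥-elim (j≢i j≡i)
  ... | no  _   = refl

  sum-δ : ∀ {k} (i : Fin k) (f : Fin k → Carrier) → sum (λ j → δ i j * f j) ≡ f i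
  sum-δ i f = begin
    sum (λ j → δ i j * f j) ≡⟨ sum-single _ i (λ j j≢i → trans (cong (_* f j) (δ-other i j j≢i)) (zeroˡ _)) ⟩
    δ i i * f i             ≡⟨ cong (_* f i) (δ-same i) ⟩
    1# * f i                ≡⟨ *-identityˡ _ ⟩
    f i                     ∎

  by-index : ∀ {k} {A : Set} (j i : Fin k) → (j ≡ i → A) → (j ≢ i → A) → A
  by-index j i same other with j ≟ᶠ i
  ... | yes j≡i = same j≡i
  ... | no  j≢i = other j≢i

  Matrix : ℕ → ℕ → Set
  Matrix ℓ m = Fin ℓ → Fin m → Carrier

  infix 4 _≐_
  _≐_ : ∀ {ℓ m} → Matrix ℓ m → Matrix ℓ m → Set
  G ≐ H = ∀ a b → G a b ≡ H a b

  comb : ∀ {k m} → (Fin k → Carrier) → Matrix k m → Fin m → Carrier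
  comb e W x = sum (λ a → e a * W a x)

  Independent : ∀ {k m} → Matrix k m → Set
  Independent W = ∀ e → (∀ x → comb e W x ≡ 0#) → ∀ a → e a ≡ 0#

  Dependence : ∀ {k m} → Matrix k m → (Fin k → Carrier) → Set
  Dependence W e = (∀ x → comb e W x ≡ 0#) × ∃ λ a → e a ≢ 0#

  IndependentRows : ∀ {ℓ m} → ℕ → Matrix ℓ m → Set
  IndependentRows {ℓ} k G = ∃ λ (s : Fin k → Fin ℓ) → Independent (G ∘ s)

  Rank : ∀ {ℓ m} → Matrix ℓ m → ℕ → Set
  Rank G r = IndependentRows r G × ¬ IndependentRows (suc r) G

  Independent-resp : ∀ {k m} {W W′ : Matrix k m} → W ≐ W′ → Independent W → Independent W′
  Independent-resp W≐W′ W-ind e e·W′≡0 =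
    W-ind e (λ x → trans (sum-cong-≗ (λ a → cong (e a *_) (W≐W′ a x))) (e·W′≡0 x))

  IndependentRows-resp : ∀ {ℓ m k} {G H : Matrix ℓ m} → G ≐ H → IndependentRows k G → IndependentRows k H
  IndependentRows-resp G≐H (s , ind) = s , Independent-resp (λ a → G≐H (s a)) ind

  Rank-resp : ∀ {ℓ m r} {G H : Matrix ℓ m} → G ≐ H → Rank G r → Rank H r
  Rank-resp G≐H (ind , ¬ind) =
    IndependentRows-resp G≐H ind , ¬ind ∘ IndependentRows-resp (λ a b → sym (G≐H a b))

  Independent-tail : ∀ {k m} (W : Matrix (suc k) m) → Independent W → Independent (tail W)
  Independent-tail W W-ind e e·W≡0 a =
    W-ind (0# ∷ᶠ e) (λ x → trans (cong (_+ comb e (tail W) x) (zeroˡ _)) (trans (+-identityˡ _) (e·W≡0 x))) (fsuc a)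

  IndependentRows-≤ : ∀ {ℓ m k k′} (G : Matrix ℓ m) → k ≤ k′ → IndependentRows k′ G → IndependentRows k G
  IndependentRows-≤ G k≤k′ = go (ℕₚ.≤⇒≤′ k≤k′)
    where
      go : ∀ {k k′} → k ℕ.≤′ k′ → IndependentRows k′ G → IndependentRows k G
      go ℕ.≤′-refl          ind           = ind
      go (ℕ.≤′-step k≤′k′) (s , s-ind) = go k≤′k′ (s ∘ fsuc , Independent-tail (G ∘ s) s-ind)

  rank-unique : ∀ {ℓ m r r′} (G : Matrix ℓ m) → Rank G r → Rank G r′ → r ≡ r′
  rank-unique {r = r} {r′} G (ind , ¬ind) (ind′ , ¬ind′) with ℕₚ.<-cmp r r′
  ... | tri< r<r′ _ _ = ⊥-elim (¬ind (IndependentRows-≤ G r<r′ ind′))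
  ... | tri≈ _ r≡r′ _ = r≡r′
  ... | tri> _ _ r′<r = ⊥-elim (¬ind′ (IndependentRows-≤ G r′<r ind))

  independent-row≢0 : ∀ {k m} (W : Matrix k m) → Independent W → ∀ a → ¬ (∀ x → W a x ≡ 0#)
  independent-row≢0 W W-ind a Wa≡0 =
    1≢0 (trans (sym (δ-same a)) (W-ind (δ a) (λ x → trans (sum-δ a (λ c → W c x)) (Wa≡0 x)) a))

  independent-rows-distinct : ∀ {k m} (W : Matrix k m) → Independent W → ∀ a b → a ≢ b →
                              ¬ (∀ x → W a x ≡ W b x)
  independent-rows-distinct {k} W W-ind a b a≢b Wa≡Wb = 1≢0 (trans (sym e-a) (W-ind e e·W≡0 a))
    where
      -- the relation W a − W b = 0
      e : Fin k → Carrier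
      e c = δ a c + - 1# * δ b c
      e-a : e a ≡ 1#
      e-a = trans (cong₂ (λ u v → u + - 1# * v) (δ-same a) (δ-other b a a≢b))
                  (trans (cong (1# +_) (zeroʳ _)) (+-identityʳ 1#))
      e·W≡0 : ∀ x → comb e W x ≡ 0#
      e·W≡0 x = begin
        sum (λ c → (δ a c + - 1# * δ b c) * W c x)
          ≡⟨ sum-cong-≗ (λ c → trans (distribʳ _ _ _) (cong (δ a c * W c x +_) (*-assoc _ _ _))) ⟩
        sum (λ c → δ a c * W c x + - 1# * (δ b c * W c x))
          ≡⟨ ∑-distrib-+ (λ c → δ a c * W c x) (λ c → - 1# * (δ b c * W c x)) ⟩
        sum (λ c → δ a c * W c x) + sum (λ c → - 1# * (δ b c * W c x))
          ≡⟨ cong₂ _+_ (sum-δ a (λ c → W c x))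
                       (trans (sym (*-distribˡ-sum (- 1#) (λ c → δ b c * W c x)))
                              (cong (- 1# *_) (sum-δ b (λ c → W c x)))) ⟩
        W a x + - 1# * W b x
          ≡⟨ cong (λ z → W a x + z) (trans (-1*x≈-x _) (cong -_ (sym (Wa≡Wb x)))) ⟩
        W a x + - W a x
          ≡⟨ -‿inverseʳ _ ⟩
        0# ∎

  ∷ᶠ-cong : ∀ {k} x {f g : Vector Carrier k} → f ≗ g → (x ∷ᶠ f) ≗ (x ∷ᶠ g)
  ∷ᶠ-cong x f≗g fzero    = refl
  ∷ᶠ-cong x f≗g (fsuc i) = f≗g i

  ∷ᶠ-η : ∀ {k} (f : Vector Carrier (suc k)) → f ≗ (head f ∷ᶠ tail f)
  ∷ᶠ-η f fzero    = refl
  ∷ᶠ-η f (fsuc i) = refl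

  -- Independence is decidable, because the field is finite: whether some
  -- coefficient vector has a decidable property is decided by running
  -- through the field elements coordinate by coordinate.
  ∃-vector? : ∀ k (P : Vector Carrier k → Set) → (∀ f → Dec (P f)) →
              (∀ {f g} → f ≗ g → P f → P g) → Dec (∃ P)
  ∃-vector? zero P P? P-resp with P? (λ ())
  ... | yes p = yes (_ , p)
  ... | no ¬p = no λ (f , pf) → ¬p (P-resp (λ ()) pf)
  ∃-vector? (suc k) P P? P-resp
    with Any.any? (λ x → ∃-vector? k (P ∘ (x ∷ᶠ_)) (P? ∘ (x ∷ᶠ_)) (P-resp ∘ ∷ᶠ-cong x)) elements
  ... | yes some = let x , f , p = Any.satisfied some in yes (x ∷ᶠ f , p)
  ... | no none = no λ (f , pf) → none (lose (elements-complete (head f)) (tail f , P-resp (∷ᶠ-η f) pf))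

  independent-or-dependent : ∀ {k m} (W : Matrix k m) → Independent W ⊎ ∃ (Dependence W)
  independent-or-dependent {k} W with ∃-vector? k (Dependence W) dependence? dependence-resp
    where
      dependence? : ∀ e → Dec (Dependence W e)
      dependence? e = all? (λ x → comb e W x ≟ 0#) ×-dec any? (λ a → ¬? (e a ≟ 0#))
      dependence-resp : ∀ {e e′} → e ≗ e′ → Dependence W e → Dependence W e′
      dependence-resp e≗e′ (e·W≡0 , a , ea≢0) =
        (λ x → trans (sum-cong-≗ (λ c → cong (_* W c x) (sym (e≗e′ c)))) (e·W≡0 x)) ,
        a , (λ e′a≡0 → ea≢0 (trans (e≗e′ a) e′a≡0))
  ... | yes dep  = inj₂ dep
  ... | no  ¬dep = inj₁ λ e e·W≡0 a →
    decidable-stable (e a ≟ 0#) (λ ea≢0 → ¬dep (e , e·W≡0 , a , ea≢0))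

  lookup-linComb : ∀ {k m} (c : Fin k → Carrier) (v : Fin k → Vec Carrier m) x →
                   lookup (linComb K c v) x ≡ comb c (λ a → lookup (v a)) x
  lookup-linComb {zero}  c v x = Vecₚ.lookup-replicate x 0#
  lookup-linComb {suc k} c v x = begin
    lookup (linComb K c v) x
      ≡⟨ Vecₚ.lookup-zipWith _+_ x (Vec.map (c fzero *_) (v fzero)) (linComb K (tail c) (tail v)) ⟩
    lookup (Vec.map (c fzero *_) (v fzero)) x + lookup (linComb K (tail c) (tail v)) x
      ≡⟨ cong₂ _+_ (Vecₚ.lookup-map x (c fzero *_) (v fzero)) (lookup-linComb (tail c) (tail v) x) ⟩
    comb c (λ a → lookup (v a)) x ∎

  vec-ext : ∀ {A : Set} {n} (u w : Vec A n) → (∀ x → lookup u x ≡ lookup w x) → u ≡ w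
  vec-ext u w u≗w = trans (sym (Vecₚ.tabulate∘lookup u)) (trans (Vecₚ.tabulate-cong u≗w) (Vecₚ.tabulate∘lookup w))

  LinIndep⇒Independent : ∀ {k m} (v : Fin k → Vec Carrier m) → LinIndep K v → Independent (λ a → lookup (v a))
  LinIndep⇒Independent v v-ind e e·v≡0 = v-ind e (vec-ext _ _ λ x →
    trans (lookup-linComb e v x) (trans (e·v≡0 x) (sym (Vecₚ.lookup-replicate x 0#))))

  Independent⇒LinIndep : ∀ {k m} (v : Fin k → Vec Carrier m) → Independent (λ a → lookup (v a)) → LinIndep K v
  Independent⇒LinIndep v v-ind e e·v≡0 = v-ind e λ x →
    trans (sym (lookup-linComb e v x)) (trans (cong (λ u → lookup u x) e·v≡0) (Vecₚ.lookup-replicate x 0#))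

  HasRank⇒Rank : ∀ {ℓ m} (M : Mat K ℓ m) r → HasRank K M r → Rank (entry K M) r
  HasRank⇒Rank M r ((s , ind) , ¬ind) =
    (s , LinIndep⇒Independent (lookup M ∘ s) ind) ,
    λ (s′ , ind′) → ¬ind s′ (Independent⇒LinIndep (lookup M ∘ s′) ind′)

  Rank⇒HasRank : ∀ {ℓ m} (M : Mat K ℓ m) r → Rank (entry K M) r → HasRank K M r
  Rank⇒HasRank M r ((s , ind) , ¬ind) =
    (s , Independent⇒LinIndep (lookup M ∘ s) ind) ,
    λ s′ ind′ → ¬ind (s′ , LinIndep⇒Independent (lookup M ∘ s′) ind′)

  data ElemOp (n : ℕ) : Set where
    scale  : (i : Fin n) (c : Carrier) → c ≢ 0# → ElemOp n
    addMul : (i j : Fin n) → i ≢ j → Carrier → ElemOp n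

  target : ∀ {n} → ElemOp n → Fin n
  target (scale i _ _)    = i
  target (addMul i _ _ _) = i

  newValue : ∀ {n} → ElemOp n → Vector Carrier n → Carrier
  newValue (scale i c _)    v = c * v i
  newValue (addMul i j _ c) v = v i + c * v j

  apply : ∀ {n} → ElemOp n → Vector Carrier n → Vector Carrier n
  apply o v = updateAt v (target o) (λ _ → newValue o v)

  apply-at : ∀ {n} (o : ElemOp n) v → apply o v (target o) ≡ newValue o v
  apply-at o v = updateAt-updates (target o) v

  apply-other : ∀ {n} (o : ElemOp n) v x → x ≢ target o → apply o v x ≡ v x
  apply-other o v x x≢i = updateAt-minimal x (target o) v x≢i

  apply-pointwise : ∀ {n} (o : ElemOp n) {f g : Vector Carrier n} →
                    f (target o) ≡ g (target o) → (∀ x → x ≢ target o → f x ≡ g x) → f ≗ g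
  apply-pointwise o at other x = by-index x (target o) (λ { refl → at }) (other x)

  apply-cong : ∀ {n} (o : ElemOp n) {v w : Vector Carrier n} → v ≗ w → apply o v ≗ apply o w
  apply-cong o {v} {w} v≗w = apply-pointwise o
    (trans (apply-at o v) (trans (newValue-cong o) (sym (apply-at o w))))
    (λ x x≢i → trans (apply-other o v x x≢i) (trans (v≗w x) (sym (apply-other o w x x≢i))))
    where
      newValue-cong : ∀ o → newValue o v ≡ newValue o w
      newValue-cong (scale i c _)    = cong (c *_) (v≗w i)
      newValue-cong (addMul i j _ c) = cong₂ (λ a b → a + c * b) (v≗w i) (v≗w j)

  apply-scalar : ∀ {n} (o : ElemOp n) c (v : Vector Carrier n) → apply o (λ y → c * v y) ≗ (λ y → c * apply o v y)
  apply-scalar o c v = apply-pointwise o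
    (trans (apply-at o _) (trans (newValue-scalar o) (cong (c *_) (sym (apply-at o v)))))
    (λ x x≢i → trans (apply-other o _ x x≢i) (cong (c *_) (sym (apply-other o v x x≢i))))
    where
      newValue-scalar : ∀ o → newValue o (λ y → c * v y) ≡ c * newValue o v
      newValue-scalar (scale i d _)    = x∙yz≈y∙xz d c (v i)
      newValue-scalar (addMul i j _ d) =
        trans (cong (c * v i +_) (x∙yz≈y∙xz d c (v j))) (sym (distribˡ c _ _))

  apply-+ : ∀ {n} (o : ElemOp n) (u w : Vector Carrier n) →
            apply o (λ y → u y + w y) ≗ (λ y → apply o u y + apply o w y)
  apply-+ o u w = apply-pointwise o
    (trans (apply-at o _) (trans (newValue-+ o) (sym (cong₂ _+_ (apply-at o u) (apply-at o w)))))
    (λ x x≢i → trans (apply-other o _ x x≢i) (sym (cong₂ _+_ (apply-other o u x x≢i) (apply-other o w x x≢i))))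
    where
      newValue-+ : ∀ o → newValue o (λ y → u y + w y) ≡ newValue o u + newValue o w
      newValue-+ (scale i d _)    = distribˡ d (u i) (w i)
      newValue-+ (addMul i j _ d) =
        trans (cong ((u i + w i) +_) (distribˡ d (u j) (w j))) (interchange (u i) (w i) _ _)

  apply-zero : ∀ {n} (o : ElemOp n) → apply o (λ _ → 0#) ≗ (λ _ → 0#)
  apply-zero o x = begin
    apply o (λ _ → 0#) x             ≡⟨ apply-cong o (λ _ → sym (zeroˡ 0#)) x ⟩
    apply o (λ _ → 0# * 0#) x        ≡⟨ apply-scalar o 0# (λ _ → 0#) x ⟩
    0# * apply o (λ _ → 0#) x        ≡⟨ zeroˡ _ ⟩
    0#                               ∎

  apply-comb : ∀ {k n} (o : ElemOp n) (e : Fin k → Carrier) (W : Matrix k n) →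
               apply o (comb e W) ≗ comb e (apply o ∘ W)
  apply-comb {zero}  o e W x = apply-zero o x
  apply-comb {suc k} o e W x =
    trans (apply-+ o (λ y → e fzero * W fzero y) (comb (tail e) (tail W)) x)
          (cong₂ _+_ (apply-scalar o (e fzero) (W fzero) x) (apply-comb o (tail e) (tail W) x))

  inverseOp : ∀ {n} → ElemOp n → ElemOp n
  inverseOp (scale i c c≢0)    = scale i (inv c c≢0) (inv≢0 c c≢0)
  inverseOp (addMul i j i≢j c) = addMul i j i≢j (- c)

  scaled-back : ∀ a b x → a * b ≡ 1# → a * (b * x) ≡ x
  scaled-back a b x ab≡1 = trans (sym (*-assoc a b x)) (trans (cong (_* x) ab≡1) (*-identityˡ x))

  added-back : ∀ x y c d → c + d ≡ 0# → (x + c * y) + d * y ≡ x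
  added-back x y c d c+d≡0 = begin
    (x + c * y) + d * y     ≡⟨ +-assoc x _ _ ⟩
    x + (c * y + d * y)     ≡⟨ cong (x +_) (sym (distribʳ y c d)) ⟩
    x + (c + d) * y         ≡⟨ cong (λ z → x + z * y) c+d≡0 ⟩
    x + 0# * y              ≡⟨ cong (x +_) (zeroˡ y) ⟩
    x + 0#                  ≡⟨ +-identityʳ x ⟩
    x                       ∎

  apply-apply-other : ∀ {n} (o o′ : ElemOp n) → target o′ ≡ target o → ∀ v x → x ≢ target o →
                      apply o′ (apply o v) x ≡ v x
  apply-apply-other o o′ same v x x≢i =
    trans (apply-other o′ _ x λ x≡i′ → x≢i (trans x≡i′ same)) (apply-other o v x x≢i)

  apply-inverseˡ : ∀ {n} (o : ElemOp n) v → apply (inverseOp o) (apply o v) ≗ v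
  apply-inverseˡ o@(scale i c c≢0) v = apply-pointwise o
    (trans (apply-at (inverseOp o) _) (trans (cong (inv c c≢0 *_) (apply-at o v)) (scaled-back _ _ _ (inv-l c c≢0))))
    (apply-apply-other o (inverseOp o) refl v)
  apply-inverseˡ o@(addMul i j i≢j c) v = apply-pointwise o
    (trans (apply-at (inverseOp o) _)
      (trans (cong₂ (λ a b → a + - c * b) (apply-at o v) (apply-other o v j (i≢j ∘ sym)))
             (added-back _ _ c (- c) (-‿inverseʳ c))))
    (apply-apply-other o (inverseOp o) refl v)

  apply-inverseʳ : ∀ {n} (o : ElemOp n) v → apply o (apply (inverseOp o) v) ≗ v
  apply-inverseʳ o@(scale i c c≢0) v = apply-pointwise o
    (trans (apply-at o _) (trans (cong (c *_) (apply-at (inverseOp o) v)) (scaled-back _ _ _ (inv-r c c≢0))))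
    (apply-apply-other (inverseOp o) o refl v)
  apply-inverseʳ o@(addMul i j i≢j c) v = apply-pointwise o
    (trans (apply-at o _)
      (trans (cong₂ (λ a b → a + c * b) (apply-at (inverseOp o) v) (apply-other (inverseOp o) v j (i≢j ∘ sym)))
             (added-back _ _ (- c) c (-‿inverseˡ c))))
    (apply-apply-other (inverseOp o) o refl v)

  dot : ∀ {n} → Vector Carrier n → Vector Carrier n → Carrier
  dot u w = sum (λ x → u x * w x)

  dot-comm : ∀ {n} (u w : Vector Carrier n) → dot u w ≡ dot w u
  dot-comm u w = sum-cong-≗ (λ x → *-comm (u x) (w x))

  adjointOp : ∀ {n} → ElemOp n → ElemOp n
  adjointOp (scale i c c≢0)    = scale i c c≢0
  adjointOp (addMul i j i≢j c) = addMul j i (i≢j ∘ sym) c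

  addMul-δ : ∀ {n} i j (i≢j : i ≢ j) c (v : Vector Carrier n) x →
             apply (addMul i j i≢j c) v x ≡ v x + δ i x * (c * v j)
  addMul-δ i j i≢j c v = apply-pointwise (addMul i j i≢j c)
    (trans (apply-at (addMul i j i≢j c) v) (cong (v i +_) (sym (trans (cong (_* _) (δ-same i)) (*-identityˡ _)))))
    (λ x x≢i → trans (apply-other (addMul i j i≢j c) v x x≢i)
                     (sym (trans (cong (v x +_) (trans (cong (_* _) (δ-other i x x≢i)) (zeroˡ _))) (+-identityʳ _))))

  dot-addMul : ∀ {n} i j (i≢j : i ≢ j) c (u w : Vector Carrier n) →
               dot (apply (addMul i j i≢j c) u) w ≡ dot u w + (c * u j) * w i
  dot-addMul i j i≢j c u w = begin
    sum (λ x → apply (addMul i j i≢j c) u x * w x)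
      ≡⟨ sum-cong-≗ (λ x → trans (cong (_* w x) (addMul-δ i j i≢j c u x))
                                 (trans (distribʳ (w x) _ _) (cong (u x * w x +_) (*-assoc _ _ _)))) ⟩
    sum (λ x → u x * w x + δ i x * ((c * u j) * w x))
      ≡⟨ ∑-distrib-+ (λ x → u x * w x) (λ x → δ i x * ((c * u j) * w x)) ⟩
    dot u w + sum (λ x → δ i x * ((c * u j) * w x))
      ≡⟨ cong (dot u w +_) (sum-δ i (λ x → (c * u j) * w x)) ⟩
    dot u w + (c * u j) * w i ∎

  apply-adjoint : ∀ {n} (o : ElemOp n) (u w : Vector Carrier n) →
                  dot (apply o u) w ≡ dot u (apply (adjointOp o) w)
  apply-adjoint o@(scale i c c≢0) u w = sum-cong-≗ (apply-pointwise o
    (trans (cong (_* w i) (apply-at o u))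
           (trans (cong (_* w i) (*-comm c (u i))) (trans (*-assoc _ _ _) (cong (u i *_) (sym (apply-at o w))))))
    (λ x x≢i → cong₂ _*_ (apply-other o u x x≢i) (sym (apply-other o w x x≢i))))
  apply-adjoint (addMul i j i≢j c) u w = begin
    dot (apply (addMul i j i≢j c) u) w     ≡⟨ dot-addMul i j i≢j c u w ⟩
    dot u w + (c * u j) * w i              ≡⟨ cong₂ _+_ (dot-comm u w) swap ⟩
    dot w u + (c * w i) * u j              ≡⟨ sym (dot-addMul j i (i≢j ∘ sym) c w u) ⟩
    dot (apply o* w) u                     ≡⟨ dot-comm _ u ⟩
    dot u (apply o* w)                     ∎
    where
      o* = addMul j i (i≢j ∘ sym) c
      swap : (c * u j) * w i ≡ (c * w i) * u j
      swap = trans (*-assoc c _ _) (trans (cong (c *_) (*-comm (u j) (w i))) (sym (*-assoc c _ _)))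

  data MatOp (ℓ m : ℕ) : Set where
    row : ElemOp ℓ → MatOp ℓ m
    col : ElemOp m → MatOp ℓ m

  act : ∀ {ℓ m} → MatOp ℓ m → Matrix ℓ m → Matrix ℓ m
  act (row o) G a b = apply o (λ a′ → G a′ b) a
  act (col o) G a   = apply o (G a)

  inverseMatOp : ∀ {ℓ m} → MatOp ℓ m → MatOp ℓ m
  inverseMatOp (row o) = row (inverseOp o)
  inverseMatOp (col o) = col (inverseOp o)

  adjointMatOp : ∀ {ℓ m} → MatOp ℓ m → MatOp ℓ m
  adjointMatOp (row o) = row (adjointOp o)
  adjointMatOp (col o) = col (adjointOp o)

  act-cong : ∀ {ℓ m} (o : MatOp ℓ m) {G H : Matrix ℓ m} → G ≐ H → act o G ≐ act o H
  act-cong (row o) G≐H a b = apply-cong o (λ a′ → G≐H a′ b) a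
  act-cong (col o) G≐H a   = apply-cong o (G≐H a)

  act-inverseˡ : ∀ {ℓ m} (o : MatOp ℓ m) (G : Matrix ℓ m) → act (inverseMatOp o) (act o G) ≐ G
  act-inverseˡ (row o) G a b = apply-inverseˡ o (λ a′ → G a′ b) a
  act-inverseˡ (col o) G a   = apply-inverseˡ o (G a)

  act-inverseʳ : ∀ {ℓ m} (o : MatOp ℓ m) (G : Matrix ℓ m) → act o (act (inverseMatOp o) G) ≐ G
  act-inverseʳ (row o) G a b = apply-inverseʳ o (λ a′ → G a′ b) a
  act-inverseʳ (col o) G a   = apply-inverseʳ o (G a)

  act-scalar : ∀ {ℓ m} (o : MatOp ℓ m) c (G : Matrix ℓ m) →
               act o (λ a b → c * G a b) ≐ (λ a b → c * act o G a b)
  act-scalar (row o) c G a b = apply-scalar o c (λ a′ → G a′ b) a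
  act-scalar (col o) c G a   = apply-scalar o c (G a)

  pair : ∀ {ℓ m} → Matrix ℓ m → Matrix ℓ m → Carrier
  pair G N = sum (λ a → dot (G a) (N a))

  pair-cong : ∀ {ℓ m} {G G′ N N′ : Matrix ℓ m} → G ≐ G′ → N ≐ N′ → pair G N ≡ pair G′ N′
  pair-cong G≐G′ N≐N′ = sum-cong-≗ λ a → sum-cong-≗ λ b → cong₂ _*_ (G≐G′ a b) (N≐N′ a b)

  act-adjoint : ∀ {ℓ m} (o : MatOp ℓ m) (G N : Matrix ℓ m) → pair (act o G) N ≡ pair G (act (adjointMatOp o) N)
  act-adjoint (col o) G N = sum-cong-≗ (λ a → apply-adjoint o (G a) (N a))
  act-adjoint (row o) G N = begin
    sum (λ a → sum (λ b → apply o (λ a′ → G a′ b) a * N a b))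
      ≡⟨ ∑-comm (λ a b → apply o (λ a′ → G a′ b) a * N a b) ⟩
    sum (λ b → dot (apply o (λ a′ → G a′ b)) (λ a′ → N a′ b))
      ≡⟨ sum-cong-≗ (λ b → apply-adjoint o (λ a′ → G a′ b) (λ a′ → N a′ b)) ⟩
    sum (λ b → sum (λ a → G a b * apply (adjointOp o) (λ a′ → N a′ b) a))
      ≡⟨ ∑-comm (λ b a → G a b * apply (adjointOp o) (λ a′ → N a′ b) a) ⟩
    pair G (act (row (adjointOp o)) N) ∎

  comb-+ : ∀ {k m} (e e′ : Fin k → Carrier) (W : Matrix k m) x →
           comb e W x + comb e′ W x ≡ comb (λ a → e a + e′ a) W x
  comb-+ e e′ W x = trans (sym (∑-distrib-+ (λ a → e a * W a x) (λ a → e′ a * W a x)))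
                          (sum-cong-≗ λ a → sym (distribʳ (W a x) (e a) (e′ a)))

  comb-scalar : ∀ {k m} c (e : Fin k → Carrier) (W : Matrix k m) x →
                c * comb e W x ≡ comb (λ a → c * e a) W x
  comb-scalar c e W x = trans (*-distribˡ-sum c (λ a → e a * W a x)) (sum-cong-≗ λ a → sym (*-assoc c (e a) (W a x)))

  Independent-apply : ∀ {k n} (o : ElemOp n) (W : Matrix k n) → Independent W → Independent (apply o ∘ W)
  Independent-apply o W W-ind e e·oW≡0 = W-ind e λ x → begin
    comb e W x                               ≡⟨ sym (apply-inverseˡ o (comb e W) x) ⟩
    apply (inverseOp o) (apply o (comb e W)) x
      ≡⟨ apply-cong (inverseOp o) (λ y → trans (apply-comb o e W y) (e·oW≡0 y)) x ⟩
    apply (inverseOp o) (λ _ → 0#) x         ≡⟨ apply-zero (inverseOp o) x ⟩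
    0#                                       ∎

  Independent-rescale : ∀ {k m} (W R : Matrix k m) →
                        (∀ a → ∃ λ d → d ≢ 0# × ∀ x → R a x ≡ d * W a x) → Independent W → Independent R
  Independent-rescale {k} W R rescaled W-ind e e·R≡0 a =
    cancel-nonzero (e a) (factor a) (W-ind (λ c → e c * factor c) e·W≡0 a) (factor≢0 a)
    where
      factor : Fin k → Carrier
      factor c = proj₁ (rescaled c)
      factor≢0 : ∀ c → factor c ≢ 0#
      factor≢0 c = proj₁ (proj₂ (rescaled c))
      R≡factor·W : ∀ c x → R c x ≡ factor c * W c x
      R≡factor·W c = proj₂ (proj₂ (rescaled c))
      e·W≡0 : ∀ x → comb (λ c → e c * factor c) W x ≡ 0#
      e·W≡0 x = trans (sum-cong-≗ λ c → trans (*-assoc _ _ _) (cong (e c *_) (sym (R≡factor·W c x)))) (e·R≡0 x)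

  replaceRow : ∀ {k m} → Matrix k m → Fin k → Vector Carrier m → Matrix k m
  replaceRow W p v = updateAt W p (λ _ → v)

  comb-replaceRow : ∀ {k m} (b : Fin k → Carrier) (W : Matrix k m) p v x →
                    comb b (replaceRow W p v) x ≡ comb (updateAt b p (λ _ → 0#)) W x + b p * v x
  comb-replaceRow b W p v x = begin
    sum (λ a → b a * replaceRow W p v a x)
      ≡⟨ sum-cong-≗ (λ a → by-index a p (λ { refl → at-p }) (other a)) ⟩
    sum (λ a → b′ a * W a x + δ p a * (b p * v x))
      ≡⟨ ∑-distrib-+ (λ a → b′ a * W a x) (λ a → δ p a * (b p * v x)) ⟩
    comb b′ W x + sum (λ a → δ p a * (b p * v x))
      ≡⟨ cong (comb b′ W x +_) (sum-δ p (λ _ → b p * v x)) ⟩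
    comb b′ W x + b p * v x ∎
    where
      b′ = updateAt b p (λ _ → 0#)
      at-p : b p * replaceRow W p v p x ≡ b′ p * W p x + δ p p * (b p * v x)
      at-p = begin
        b p * replaceRow W p v p x        ≡⟨ cong (λ u → b p * u x) (updateAt-updates p W) ⟩
        b p * v x                          ≡⟨ sym (*-identityˡ _) ⟩
        1# * (b p * v x)                   ≡⟨ sym (+-identityˡ _) ⟩
        0# + 1# * (b p * v x)              ≡⟨ cong₂ _+_ (sym (trans (cong (_* W p x) (updateAt-updates p b)) (zeroˡ _)))
                                                       (cong (_* _) (sym (δ-same p))) ⟩
        b′ p * W p x + δ p p * (b p * v x) ∎
      other : ∀ a → a ≢ p → b a * replaceRow W p v a x ≡ b′ a * W a x + δ p a * (b p * v x)
      other a a≢p = begin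
        b a * replaceRow W p v a x          ≡⟨ cong₂ (λ c u → c * u x) (sym (updateAt-minimal a p b a≢p))
                                                                  (updateAt-minimal a p W a≢p) ⟩
        b′ a * W a x                         ≡⟨ sym (+-identityʳ _) ⟩
        b′ a * W a x + 0#
          ≡⟨ cong (b′ a * W a x +_) (sym (trans (cong (_* _) (δ-other p a a≢p)) (zeroˡ _))) ⟩
        b′ a * W a x + δ p a * (b p * v x)   ∎

  exchange : ∀ {k m} (W : Matrix k m) (β : Fin k → Carrier) p → β p ≢ 0# → Independent W →
             Independent (replaceRow W p (comb β W))
  exchange {k} W β p βp≢0 W-ind b b·W′≡0 a = by-index a p (λ { refl → bp≡0 }) bₐ≡0
    where
      -- the relation b rewritten as a relation among the original rows
      b′ : Fin k → Carrier
      b′ a = updateAt b p (λ _ → 0#) a + b p * β a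
      b′≡0 : ∀ a → b′ a ≡ 0#
      b′≡0 = W-ind b′ λ x → begin
        comb b′ W x
          ≡⟨ sym (comb-+ (updateAt b p (λ _ → 0#)) (λ a → b p * β a) W x) ⟩
        comb (updateAt b p (λ _ → 0#)) W x + comb (λ a → b p * β a) W x
          ≡⟨ cong (comb (updateAt b p (λ _ → 0#)) W x +_) (sym (comb-scalar (b p) β W x)) ⟩
        comb (updateAt b p (λ _ → 0#)) W x + b p * comb β W x
          ≡⟨ sym (comb-replaceRow b W p (comb β W) x) ⟩
        comb b (replaceRow W p (comb β W)) x
          ≡⟨ b·W′≡0 x ⟩
        0# ∎
      bp≡0 : b p ≡ 0#
      bp≡0 = cancel-nonzero (b p) (β p)
        (trans (sym (+-identityˡ _)) (trans (cong (_+ b p * β p) (sym (updateAt-updates p b))) (b′≡0 p))) βp≢0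
      bₐ≡0 : a ≢ p → b a ≡ 0#
      bₐ≡0 a≢p = begin
        b a                                        ≡⟨ sym (updateAt-minimal a p b a≢p) ⟩
        updateAt b p (λ _ → 0#) a                  ≡⟨ sym (+-identityʳ _) ⟩
        updateAt b p (λ _ → 0#) a + 0#             ≡⟨ cong (_ +_) (sym (trans (cong (_* β a) bp≡0) (zeroˡ _))) ⟩
        b′ a                                       ≡⟨ b′≡0 a ⟩
        0#                                         ∎

  comb-addMul : ∀ {ℓ m k} i j (i≢j : i ≢ j) c (G : Matrix ℓ m) (s : Fin k → Fin ℓ) (e : Fin k → Carrier) x →
    comb e (act (row (addMul i j i≢j c)) G ∘ s) x ≡ comb e (G ∘ s) x + (sum (λ a → e a * δ i (s a)) * c) * G j x
  comb-addMul i j i≢j c G s e x = begin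
    comb e (act (row (addMul i j i≢j c)) G ∘ s) x
      ≡⟨ sum-cong-≗ (λ a → trans (cong (e a *_) (addMul-δ i j i≢j c (λ a′ → G a′ x) (s a)))
                         (trans (distribˡ (e a) _ _) (cong (e a * G (s a) x +_) (sym (*-assoc _ _ _))))) ⟩
    sum (λ a → e a * G (s a) x + (e a * δ i (s a)) * (c * G j x))
      ≡⟨ ∑-distrib-+ (λ a → e a * G (s a) x) (λ a → (e a * δ i (s a)) * (c * G j x)) ⟩
    comb e (G ∘ s) x + sum (λ a → (e a * δ i (s a)) * (c * G j x))
      ≡⟨ cong (comb e (G ∘ s) x +_) (trans (sym (*-distribʳ-sum (c * G j x) (λ a → e a * δ i (s a))))
                                            (sym (*-assoc _ c _))) ⟩
    comb e (G ∘ s) x + (sum (λ a → e a * δ i (s a)) * c) * G j x ∎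

  addMul-dependence : ∀ {ℓ m k} i j (i≢j : i ≢ j) c (G : Matrix ℓ m) (s : Fin k → Fin ℓ) →
    Independent (G ∘ s) → ∃ (Dependence (act (row (addMul i j i≢j c)) G ∘ s)) →
    ∃ λ p → s p ≡ i × ∃ λ β → β p ≢ 0# × (∀ x → G j x ≡ comb β (G ∘ s) x)
  addMul-dependence {k = k} i j i≢j c G s W-ind (e , e·R≡0 , q , eq≢0) = p , sp≡i , β , βp≢0 , Gj≡β·W
    where
      W : Matrix k _
      W = G ∘ s
      -- the total coefficient with which row i enters the relation e
      α : Carrier
      α = sum {k} (λ a → e a * δ i (s a))
      relation : ∀ x → comb e W x + (α * c) * G j x ≡ 0#
      relation x = trans (sym (comb-addMul i j i≢j c G s e x)) (e·R≡0 x)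
      αc≢0 : α * c ≢ 0#
      αc≢0 αc≡0 = eq≢0 (W-ind e (λ x → begin
        comb e W x                   ≡⟨ sym (+-identityʳ _) ⟩
        comb e W x + 0#              ≡⟨ cong (comb e W x +_) (sym (trans (cong (_* G j x) αc≡0) (zeroˡ _))) ⟩
        comb e W x + (α * c) * G j x ≡⟨ relation x ⟩
        0#                           ∎) q)
      α≢0 : α ≢ 0#
      α≢0 α≡0 = αc≢0 (trans (cong (_* c) α≡0) (zeroˡ c))
      p : Fin k
      p = proj₁ (sum-nonzero (λ a → e a * δ i (s a)) α≢0)
      ep·δ≢0 : e p * δ i (s p) ≢ 0#
      ep·δ≢0 = proj₂ (sum-nonzero (λ a → e a * δ i (s a)) α≢0)
      sp≡i : s p ≡ i
      sp≡i = by-index (s p) i (λ sp≡i → sp≡i)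
        (λ sp≢i → ⊥-elim (ep·δ≢0 (trans (cong (e p *_) (δ-other i (s p) sp≢i)) (zeroʳ _))))
      ep≢0 : e p ≢ 0#
      ep≢0 ep≡0 = ep·δ≢0 (trans (cong (_* δ i (s p)) ep≡0) (zeroˡ _))
      γ = inv (α * c) αc≢0
      β : Fin k → Carrier
      β a = - γ * e a
      βp≢0 : β p ≢ 0#
      βp≢0 = *≢0 _ _ (-≢0 γ (inv≢0 _ αc≢0)) ep≢0
      Gj≡β·W : ∀ x → G j x ≡ comb β W x
      Gj≡β·W x = begin
        G j x                      ≡⟨ sym (scaled-back γ (α * c) (G j x) (inv-l _ αc≢0)) ⟩
        γ * ((α * c) * G j x)      ≡⟨ cong (γ *_) (+-inverseʳ-unique (comb e W x) _ (relation x)) ⟩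
        γ * - comb e W x           ≡⟨ sym (-‿distribʳ-* γ _) ⟩
        - (γ * comb e W x)         ≡⟨ -‿distribˡ-* γ _ ⟩
        - γ * comb e W x           ≡⟨ comb-scalar (- γ) e W x ⟩
        comb β W x                 ∎

  -- In the situation of addMul-dependence, replacing row i = s p by row j in
  -- the selection gives independent rows after the operation: they are the
  -- rows s with row p exchanged for a combination with nonzero coefficient.
  exchange-selected : ∀ {ℓ m k} i j (i≢j : i ≢ j) c (G : Matrix ℓ m) (s : Fin k → Fin ℓ) →
    Independent (G ∘ s) → (p : Fin k) → s p ≡ i → (β : Fin k → Carrier) → β p ≢ 0# →
    (∀ x → G j x ≡ comb β (G ∘ s) x) →
    Independent (act (row (addMul i j i≢j c)) G ∘ updateAt s p (λ _ → j))
  exchange-selected i j i≢j c G s W-ind p sp≡i β βp≢0 Gj≡β·W =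
    Independent-resp (λ a x → sym (rows a x)) (exchange W β p βp≢0 W-ind)
    where
      W = G ∘ s
      o = addMul i j i≢j c
      s′ = updateAt s p (λ _ → j)
      rows : ∀ a x → act (row o) G (s′ a) x ≡ replaceRow W p (comb β W) a x
      rows a x = by-index a p
        (λ a≡p → begin
          act (row o) G (s′ a) x
            ≡⟨ cong (λ u → act (row o) G u x) (trans (cong s′ a≡p) (updateAt-updates p s)) ⟩
          apply o (λ a′ → G a′ x) j
            ≡⟨ apply-other o _ j (i≢j ∘ sym) ⟩
          G j x
            ≡⟨ Gj≡β·W x ⟩
          comb β W x
            ≡⟨ cong (λ u → u x) (sym (trans (cong (replaceRow W p (comb β W)) a≡p) (updateAt-updates p W))) ⟩
          replaceRow W p (comb β W) a x ∎)
        (λ a≢p → begin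
          act (row o) G (s′ a) x
            ≡⟨ cong (λ u → act (row o) G u x) (updateAt-minimal a p s a≢p) ⟩
          apply o (λ a′ → G a′ x) (s a)
            ≡⟨ apply-other o _ (s a) (λ sa≡i → independent-rows-distinct W W-ind a p a≢p
                 (λ y → cong (λ u → G u y) (trans sa≡i (sym sp≡i)))) ⟩
          W a x
            ≡⟨ cong (λ u → u x) (sym (updateAt-minimal a p W a≢p)) ⟩
          replaceRow W p (comb β W) a x ∎)

  -- Adding a multiple of one row to another keeps k rows independent: either
  -- the same rows stay independent, or row j can take the place of row i.
  IndependentRows-addMul : ∀ {ℓ m k} i j (i≢j : i ≢ j) c (G : Matrix ℓ m) →
    IndependentRows k G → IndependentRows k (act (row (addMul i j i≢j c)) G)
  IndependentRows-addMul i j i≢j c G (s , W-ind) =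
    [ (λ R-ind → s , R-ind) , exchanged ]′ (independent-or-dependent (act (row (addMul i j i≢j c)) G ∘ s))
    where
      exchanged : ∃ (Dependence (act (row (addMul i j i≢j c)) G ∘ s)) →
                  IndependentRows _ (act (row (addMul i j i≢j c)) G)
      exchanged dep =
        let p , sp≡i , β , βp≢0 , Gj≡β·W = addMul-dependence i j i≢j c G s W-ind dep
        in  updateAt s p (λ _ → j) , exchange-selected i j i≢j c G s W-ind p sp≡i β βp≢0 Gj≡β·W

  IndependentRows-act : ∀ {ℓ m k} (o : MatOp ℓ m) (G : Matrix ℓ m) → IndependentRows k G → IndependentRows k (act o G)
  IndependentRows-act (col o) G (s , W-ind) = s , Independent-apply o (G ∘ s) W-ind
  IndependentRows-act (row (addMul i j i≢j c)) G ind = IndependentRows-addMul i j i≢j c G ind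
  IndependentRows-act (row o@(scale i c c≢0)) G (s , W-ind) = s , Independent-rescale (G ∘ s) _ factor W-ind
    where
      factor : ∀ a → ∃ λ d → d ≢ 0# × ∀ x → act (row o) G (s a) x ≡ d * G (s a) x
      factor a = by-index (s a) i
        (λ sa≡i → c , c≢0 , λ x → trans (cong (apply o (λ a′ → G a′ x)) sa≡i)
                                   (trans (apply-at o _) (cong (λ u → c * G u x) (sym sa≡i))))
        (λ sa≢i → 1# , 1≢0 , λ x → trans (apply-other o _ (s a) sa≢i) (sym (*-identityˡ _)))

  Rank-act : ∀ {ℓ m r} (o : MatOp ℓ m) (G : Matrix ℓ m) → Rank G r → Rank (act o G) r
  Rank-act o G (ind , ¬ind) =
    IndependentRows-act o G ind ,
    λ ind′ → ¬ind (IndependentRows-resp (act-inverseˡ o G) (IndependentRows-act (inverseMatOp o) _ ind′))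

  actAll : ∀ {ℓ m} → List (MatOp ℓ m) → Matrix ℓ m → Matrix ℓ m
  actAll []       G = G
  actAll (o ∷ os) G = actAll os (act o G)

  actAll-cong : ∀ {ℓ m} (os : List (MatOp ℓ m)) {G H : Matrix ℓ m} → G ≐ H → actAll os G ≐ actAll os H
  actAll-cong []       G≐H = G≐H
  actAll-cong (o ∷ os) G≐H = actAll-cong os (act-cong o G≐H)

  actAll-++ : ∀ {ℓ m} (os os′ : List (MatOp ℓ m)) (G : Matrix ℓ m) →
              actAll (os ++ os′) G ≡ actAll os′ (actAll os G)
  actAll-++ []       os′ G = refl
  actAll-++ (o ∷ os) os′ G = actAll-++ os os′ (act o G)

  Rank-actAll : ∀ {ℓ m r} (os : List (MatOp ℓ m)) (G : Matrix ℓ m) → Rank G r → Rank (actAll os G) r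
  Rank-actAll []       G rk = rk
  Rank-actAll (o ∷ os) G rk = Rank-actAll os (act o G) (Rank-act o G rk)

  toMat : ∀ {ℓ m} → Matrix ℓ m → Mat K ℓ m
  toMat G = tabulate λ a → tabulate (G a)

  entry-toMat : ∀ {ℓ m} (G : Matrix ℓ m) → entry K (toMat G) ≐ G
  entry-toMat G a b = trans (cong (λ v → lookup v b) (Vecₚ.lookup∘tabulate _ a)) (Vecₚ.lookup∘tabulate _ b)

  τ : ∀ {ℓ m} → ℕ → Matrix ℓ m
  τ r = entry K (partialTrace K r)

  OnDiagonal : ∀ {ℓ m} → ℕ → Fin ℓ → Fin m → Set
  OnDiagonal r a b = toℕ a ≡ toℕ b × toℕ a < r

  τ-value : ∀ {ℓ m} r (a : Fin ℓ) (b : Fin m) →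
            (OnDiagonal r a b → τ r a b ≡ 1#) × (¬ OnDiagonal r a b → τ r a b ≡ 0#)
  τ-value {ℓ} {m} r a b rewrite (τ {ℓ} {m} r a b ≡ _ ∋ entry-toMat _ a b)
    with (toℕ a ℕ.≟ toℕ b) ×-dec (toℕ a <? r)
  ... | yes diag = (λ _ → refl) , (λ off → ⊥-elim (off diag))
  ... | no  off  = (λ diag → ⊥-elim (off diag)) , (λ _ → refl)

  τ-one : ∀ {ℓ m} r (a : Fin ℓ) (b : Fin m) → OnDiagonal r a b → τ r a b ≡ 1#
  τ-one r a b = proj₁ (τ-value r a b)

  τ-zero : ∀ {ℓ m} r (a : Fin ℓ) (b : Fin m) → ¬ OnDiagonal r a b → τ r a b ≡ 0#
  τ-zero r a b = proj₂ (τ-value r a b)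

  -- The first r rows of τ_r are independent: row a has its only 1 in column a.
  τ-diagonal-rows : ∀ {ℓ m} r (r≤ℓ : r ≤ ℓ) (r≤m : r ≤ m) →
                    Independent {r} {m} (λ a → τ r (Fin.inject≤ a r≤ℓ))
  τ-diagonal-rows {ℓ} {m} r r≤ℓ r≤m e e·τ≡0 a = begin
    e a                                   ≡⟨ sym (*-identityʳ (e a)) ⟩
    e a * 1#                              ≡⟨ cong (e a *_) (sym (τ-one r (diag-row a) (diag-col a) on-diagonal)) ⟩
    e a * τ r (diag-row a) (diag-col a)   ≡⟨ sym (sum-single (λ c → e c * τ r (diag-row c) (diag-col a)) a off-diagonal) ⟩
    comb e (τ r ∘ diag-row) (diag-col a)  ≡⟨ e·τ≡0 (diag-col a) ⟩
    0#                                    ∎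
    where
      diag-row : Fin r → Fin ℓ
      diag-row c = Fin.inject≤ c r≤ℓ
      diag-col : Fin r → Fin m
      diag-col c = Fin.inject≤ c r≤m
      on-diagonal : OnDiagonal r (diag-row a) (diag-col a)
      on-diagonal = trans (toℕ-inject≤ a r≤ℓ) (sym (toℕ-inject≤ a r≤m)) ,
                    subst (_< r) (sym (toℕ-inject≤ a r≤ℓ)) (toℕ<n a)
      off-diagonal : ∀ c → c ≢ a → e c * τ r (diag-row c) (diag-col a) ≡ 0#
      off-diagonal c c≢a = trans (cong (e c *_) (τ-zero r _ _ λ (same , _) → c≢a (toℕ-injective
        (trans (sym (toℕ-inject≤ c r≤ℓ)) (trans same (toℕ-inject≤ a r≤m)))))) (zeroʳ _)

  -- τ_r has no r + 1 independent rows: such rows are nonzero, so they lie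
  -- among the first r, and by pigeonhole two of them coincide.
  τ-few-rows : ∀ {ℓ m} r → ¬ IndependentRows {ℓ} {m} (suc r) (τ r)
  τ-few-rows r (s , ind) =
    let i , j , i<j , ri≡rj = pigeonhole (ℕₚ.n<1+n r) (λ a → Fin.fromℕ< (index<r a))
    in  independent-rows-distinct (τ r ∘ s) ind i j (<⇒≢ i<j) λ x → cong (λ u → τ r u x) (same-row ri≡rj)
    where
      index<r : ∀ a → toℕ (s a) < r
      index<r a with toℕ (s a) <? r
      ... | yes lt = lt
      ... | no ¬lt = ⊥-elim (independent-row≢0 (τ r ∘ s) ind a λ x → τ-zero r (s a) x λ (_ , lt) → ¬lt lt)
      same-row : ∀ {i j} → Fin.fromℕ< (index<r i) ≡ Fin.fromℕ< (index<r j) → s i ≡ s j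
      same-row {i} {j} ri≡rj = toℕ-injective
        (trans (sym (toℕ-fromℕ< (index<r i))) (trans (cong toℕ ri≡rj) (toℕ-fromℕ< (index<r j))))

  Rank-τ : ∀ {ℓ m} r → r ≤ ℓ → r ≤ m → Rank {ℓ} {m} (τ r) r
  Rank-τ r r≤ℓ r≤m = ((λ a → Fin.inject≤ a r≤ℓ) , τ-diagonal-rows r r≤ℓ r≤m) , τ-few-rows r

  applyAll : ∀ {n} → List (ElemOp n) → Vector Carrier n → Vector Carrier n
  applyAll []       v = v
  applyAll (o ∷ os) v = applyAll os (apply o v)

  actAll-rows : ∀ {ℓ m} (os : List (ElemOp ℓ)) (G : Matrix ℓ m) a b →
                actAll (List.map row os) G a b ≡ applyAll os (λ a′ → G a′ b) a
  actAll-rows []       G a b = refl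
  actAll-rows (o ∷ os) G a b = actAll-rows os (act (row o) G) a b

  actAll-cols : ∀ {ℓ m} (os : List (ElemOp m)) (G : Matrix ℓ m) a b →
                actAll (List.map col os) G a b ≡ applyAll os (G a) b
  actAll-cols []       G a b = refl
  actAll-cols (o ∷ os) G a b = actAll-cols os (act (col o) G) a b

  clearOps : ∀ {n} → (Fin n → Carrier) → List (Fin n) → List (ElemOp (suc n))
  clearOps κ = List.map (λ a → addMul (fsuc a) fzero (λ ()) (κ a))

  -- Its effect; the statement about unlisted indices carries the induction.
  applyAll-clearOps : ∀ {n} (κ : Fin n → Carrier) (xs : List (Fin n)) → AllPairs _≢_ xs →
    ∀ (v : Vector Carrier (suc n)) →
      applyAll (clearOps κ xs) v fzero ≡ v fzero
    × (∀ a → a ∈ xs → applyAll (clearOps κ xs) v (fsuc a) ≡ v (fsuc a) + κ a * v fzero)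
    × (∀ a → ¬ a ∈ xs → applyAll (clearOps κ xs) v (fsuc a) ≡ v (fsuc a))
  applyAll-clearOps κ []       _                 v = refl , (λ _ ()) , (λ _ _ → refl)
  applyAll-clearOps κ (x ∷ xs) (x∉xs ∷ distinct) v = at-0 , at-listed , at-unlisted
    where
      o = addMul (fsuc x) fzero (λ ()) (κ x)
      rest = applyAll-clearOps κ xs distinct (apply o v)
      o-0 : apply o v fzero ≡ v fzero
      o-0 = apply-other o v fzero λ ()
      o-other : ∀ a → a ≢ x → apply o v (fsuc a) ≡ v (fsuc a)
      o-other a a≢x = apply-other o v (fsuc a) (a≢x ∘ suc-injective)
      at-0 : applyAll (clearOps κ xs) (apply o v) fzero ≡ v fzero
      at-0 = trans (proj₁ rest) o-0
      at-listed : ∀ a → a ∈ x ∷ xs → applyAll (clearOps κ xs) (apply o v) (fsuc a) ≡ v (fsuc a) + κ a * v fzero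
      at-listed a (here refl) = trans (proj₂ (proj₂ rest) a (λ a∈xs → All.lookup x∉xs a∈xs refl)) (apply-at o v)
      at-listed a (there a∈xs) =
        trans (proj₁ (proj₂ rest) a a∈xs)
              (cong₂ (λ p q → p + κ a * q) (o-other a (λ a≡x → All.lookup x∉xs a∈xs (sym a≡x))) o-0)
      at-unlisted : ∀ a → ¬ a ∈ x ∷ xs → applyAll (clearOps κ xs) (apply o v) (fsuc a) ≡ v (fsuc a)
      at-unlisted a a∉ = trans (proj₂ (proj₂ rest) a (a∉ ∘ there)) (o-other a (a∉ ∘ here))

  clearAll : ∀ {n} → (Fin n → Carrier) → List (ElemOp (suc n))
  clearAll {n} κ = clearOps κ (List.allFin n)

  clearAll-0 : ∀ {n} (κ : Fin n → Carrier) v → applyAll (clearAll κ) v fzero ≡ v fzero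
  clearAll-0 {n} κ v = proj₁ (applyAll-clearOps κ (List.allFin n) (allFin⁺ n) v)

  clearAll-suc : ∀ {n} (κ : Fin n → Carrier) v a → applyAll (clearAll κ) v (fsuc a) ≡ v (fsuc a) + κ a * v fzero
  clearAll-suc {n} κ v a = proj₁ (proj₂ (applyAll-clearOps κ (List.allFin n) (allFin⁺ n) v)) a (∈-allFin a)

  clearAll-pivot : ∀ {n} (κ : Fin n → Carrier) v a → v fzero ≡ 1# → κ a ≡ - v (fsuc a) →
                   applyAll (clearAll κ) v (fsuc a) ≡ 0#
  clearAll-pivot κ v a v0≡1 κa≡-va = begin
    applyAll (clearAll κ) v (fsuc a)   ≡⟨ clearAll-suc κ v a ⟩
    v (fsuc a) + κ a * v fzero          ≡⟨ cong₂ (λ p q → v (fsuc a) + p * q) κa≡-va v0≡1 ⟩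
    v (fsuc a) + - v (fsuc a) * 1#      ≡⟨ cong (v (fsuc a) +_) (*-identityʳ _) ⟩
    v (fsuc a) + - v (fsuc a)           ≡⟨ -‿inverseʳ _ ⟩
    0#                                  ∎

  block : ∀ {ℓ m} → Matrix ℓ m → Matrix (suc ℓ) (suc m)
  block H fzero    fzero    = 1#
  block H fzero    (fsuc b) = 0#
  block H (fsuc a) fzero    = 0#
  block H (fsuc a) (fsuc b) = H a b

  block-cong : ∀ {ℓ m} {H H′ : Matrix ℓ m} → H ≐ H′ → block H ≐ block H′
  block-cong H≐H′ fzero    fzero    = refl
  block-cong H≐H′ fzero    (fsuc b) = refl
  block-cong H≐H′ (fsuc a) fzero    = refl
  block-cong H≐H′ (fsuc a) (fsuc b) = H≐H′ a b

  block-τ : ∀ {ℓ m} r → block {ℓ} {m} (τ r) ≐ τ (suc r)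
  block-τ {ℓ} {m} r fzero    fzero    = sym (τ-one {suc ℓ} {suc m} (suc r) fzero fzero (refl , s≤s z≤n))
  block-τ {ℓ} {m} r fzero    (fsuc b) = sym (τ-zero {suc ℓ} (suc r) fzero (fsuc b) λ ())
  block-τ {ℓ} {m} r (fsuc a) fzero    = sym (τ-zero {m = suc m} (suc r) (fsuc a) fzero λ ())
  block-τ r (fsuc a) (fsuc b) with (toℕ a ℕ.≟ toℕ b) ×-dec (toℕ a <? r)
  ... | yes (same , a<r) =
    trans (τ-one r a b (same , a<r)) (sym (τ-one (suc r) (fsuc a) (fsuc b) (cong suc same , s≤s a<r)))
  ... | no  off =
    trans (τ-zero r a b off)
          (sym (τ-zero (suc r) (fsuc a) (fsuc b) λ { (same , s≤s a<r) → off (ℕₚ.suc-injective same , a<r) }))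

  liftOp : ∀ {n} → ElemOp n → ElemOp (suc n)
  liftOp (scale i c c≢0)    = scale (fsuc i) c c≢0
  liftOp (addMul i j i≢j c) = addMul (fsuc i) (fsuc j) (i≢j ∘ suc-injective) c

  target-lift : ∀ {n} (o : ElemOp n) → target (liftOp o) ≡ fsuc (target o)
  target-lift (scale _ _ _)    = refl
  target-lift (addMul _ _ _ _) = refl

  apply-lift-0 : ∀ {n} (o : ElemOp n) v → apply (liftOp o) v fzero ≡ v fzero
  apply-lift-0 o v = apply-other (liftOp o) v fzero λ 0≡i → 0≢1+n (trans 0≡i (target-lift o))

  apply-lift-suc : ∀ {n} (o : ElemOp n) v x → apply (liftOp o) v (fsuc x) ≡ apply o (tail v) x
  apply-lift-suc o v = apply-pointwise o (at o)
    (λ x x≢i → trans (apply-other (liftOp o) v (fsuc x) λ e → x≢i (suc-injective (trans e (target-lift o))))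
                     (sym (apply-other o (tail v) x x≢i)))
    where
      at : ∀ o → apply (liftOp o) v (fsuc (target o)) ≡ apply o (tail v) (target o)
      at o@(scale _ _ _)    = trans (apply-at (liftOp o) v) (sym (apply-at o (tail v)))
      at o@(addMul _ _ _ _) = trans (apply-at (liftOp o) v) (sym (apply-at o (tail v)))

  liftMatOp : ∀ {ℓ m} → MatOp ℓ m → MatOp (suc ℓ) (suc m)
  liftMatOp (row o) = row (liftOp o)
  liftMatOp (col o) = col (liftOp o)

  act-lift : ∀ {ℓ m} (o : MatOp ℓ m) (H : Matrix ℓ m) → act (liftMatOp o) (block H) ≐ block (act o H)
  act-lift (row o) H fzero    fzero    = apply-lift-0 o _
  act-lift (row o) H fzero    (fsuc b) = apply-lift-0 o _
  act-lift (row o) H (fsuc a) fzero    = trans (apply-lift-suc o _ a) (apply-zero o a)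
  act-lift (row o) H (fsuc a) (fsuc b) = apply-lift-suc o _ a
  act-lift (col o) H fzero    fzero    = apply-lift-0 o _
  act-lift (col o) H (fsuc a) fzero    = apply-lift-0 o _
  act-lift (col o) H fzero    (fsuc b) = trans (apply-lift-suc o _ b) (apply-zero o b)
  act-lift (col o) H (fsuc a) (fsuc b) = apply-lift-suc o _ b

  actAll-lift : ∀ {ℓ m} (os : List (MatOp ℓ m)) (H : Matrix ℓ m) →
                actAll (List.map liftMatOp os) (block H) ≐ block (actAll os H)
  actAll-lift []       H = λ _ _ → refl
  actAll-lift (o ∷ os) H a b = trans (actAll-cong (List.map liftMatOp os) (act-lift o H) a b) (actAll-lift os (act o H) a b)

  Reduction : ∀ {ℓ m} → Matrix ℓ m → Set
  Reduction {ℓ} {m} G = ∃ λ (os : List (MatOp ℓ m)) → ∃ λ r → r ≤ ℓ × r ≤ m × actAll os G ≐ τ r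

  Reduction-after : ∀ {ℓ m} (os : List (MatOp ℓ m)) {G G′ : Matrix ℓ m} →
                    actAll os G ≐ G′ → Reduction G′ → Reduction G
  Reduction-after os {G} {G′} G↦G′ (os′ , r , r≤ℓ , r≤m , G′↦τ) = os ++ os′ , r , r≤ℓ , r≤m , λ a b → begin
    actAll (os ++ os′) G a b      ≡⟨ cong (λ H → H a b) (actAll-++ os os′ G) ⟩
    actAll os′ (actAll os G) a b  ≡⟨ actAll-cong os′ G↦G′ a b ⟩
    actAll os′ G′ a b             ≡⟨ G′↦τ a b ⟩
    τ r a b                       ∎

  Reduction-zero : ∀ {ℓ m} {G : Matrix ℓ m} → (∀ a b → G a b ≡ 0#) → Reduction G
  Reduction-zero G≡0 = [] , 0 , z≤n , z≤n , λ a b → trans (G≡0 a b) (sym (τ-zero 0 a b λ ()))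

  Reduction-block : ∀ {ℓ m} {H : Matrix ℓ m} → Reduction H → Reduction (block H)
  Reduction-block {H = H} (os , r , r≤ℓ , r≤m , H↦τ) =
    List.map liftMatOp os , suc r , s≤s r≤ℓ , s≤s r≤m ,
    λ a b → trans (actAll-lift os H a b) (trans (block-cong H↦τ a b) (block-τ r a b))

  nonzero-to-front : ∀ {n} (v : Vector Carrier (suc n)) a → v a ≢ 0# →
                     ∃ λ (os : List (ElemOp (suc n))) → applyAll os v fzero ≢ 0#
  nonzero-to-front v a va≢0 with v fzero ≟ 0#
  ... | no  v0≢0 = [] , v0≢0
  ... | yes v0≡0 = addMul fzero a 0≢a 1# ∷ [] , λ sum≡0 → va≢0 (begin
    v a                       ≡⟨ sym (*-identityˡ _) ⟩
    1# * v a                  ≡⟨ sym (+-identityˡ _) ⟩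
    0# + 1# * v a             ≡⟨ cong (_+ 1# * v a) (sym v0≡0) ⟩
    v fzero + 1# * v a        ≡⟨ sym (apply-at (addMul fzero a 0≢a 1#) v) ⟩
    apply (addMul fzero a 0≢a 1#) v fzero ≡⟨ sum≡0 ⟩
    0#                        ∎)
    where
      0≢a : fzero ≢ a
      0≢a refl = va≢0 v0≡0

  pivot-to-corner : ∀ {ℓ m} (G : Matrix (suc ℓ) (suc m)) a b → G a b ≢ 0# →
                    ∃ λ (os : List (MatOp (suc ℓ) (suc m))) → actAll os G fzero fzero ≢ 0#
  pivot-to-corner G a b Gab≢0 =
    let rowOps , front≢0  = nonzero-to-front (λ a′ → G a′ b) a Gab≢0
        H                 = actAll (List.map row rowOps) G
        colOps , corner≢0 = nonzero-to-front (H fzero) b (front≢0 ∘ trans (sym (actAll-rows rowOps G fzero b)))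
    in  List.map row rowOps ++ List.map col colOps ,
        λ corner≡0 → corner≢0 (begin
          applyAll colOps (H fzero) fzero
            ≡⟨ sym (actAll-cols colOps H fzero fzero) ⟩
          actAll (List.map col colOps) H fzero fzero
            ≡⟨ cong (λ M → M fzero fzero) (sym (actAll-++ (List.map row rowOps) _ G)) ⟩
          actAll (List.map row rowOps ++ List.map col colOps) G fzero fzero
            ≡⟨ corner≡0 ⟩
          0# ∎)

  normalize-corner : ∀ {ℓ m} (G : Matrix (suc ℓ) (suc m)) → G fzero fzero ≢ 0# →
                     ∃ λ (os : List (MatOp (suc ℓ) (suc m))) → actAll os G fzero fzero ≡ 1#
  normalize-corner G g≢0 = row o ∷ [] , trans (apply-at o (λ a → G a fzero)) (inv-l _ g≢0)
    where o = scale fzero (inv _ g≢0) (inv≢0 _ g≢0)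

  clear-corner : ∀ {ℓ m} (G : Matrix (suc ℓ) (suc m)) → G fzero fzero ≡ 1# →
                 ∃ λ (os : List (MatOp (suc ℓ) (suc m))) → ∃ λ H → actAll os G ≐ block H
  clear-corner G G00≡1 =
    rowOps ++ colOps , (λ a b → H′ (fsuc a) (fsuc b)) ,
    λ a b → trans (cong (λ M → M a b) (actAll-++ rowOps colOps G)) (shape a b)
    where
      κ = λ a → - G (fsuc a) fzero
      rowOps = List.map row (clearAll κ)
      H = actAll rowOps G
      H-0 : ∀ b → H fzero b ≡ G fzero b
      H-0 b = trans (actAll-rows (clearAll κ) G fzero b) (clearAll-0 κ _)
      H-col : ∀ a → H (fsuc a) fzero ≡ 0#
      H-col a = trans (actAll-rows (clearAll κ) G (fsuc a) fzero) (clearAll-pivot κ _ a G00≡1 refl)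
      μ = λ b → - H fzero (fsuc b)
      colOps = List.map col (clearAll μ)
      H′ = actAll colOps H
      H′-col : ∀ a → H′ a fzero ≡ H a fzero
      H′-col a = trans (actAll-cols (clearAll μ) H a fzero) (clearAll-0 μ _)
      H00≡1 : H fzero fzero ≡ 1#
      H00≡1 = trans (H-0 fzero) G00≡1
      shape : H′ ≐ block (λ a b → H′ (fsuc a) (fsuc b))
      shape fzero    fzero    = trans (H′-col fzero) H00≡1
      shape fzero    (fsuc b) = trans (actAll-cols (clearAll μ) H fzero (fsuc b)) (clearAll-pivot μ _ b H00≡1 refl)
      shape (fsuc a) fzero    = trans (H′-col (fsuc a)) (H-col a)
      shape (fsuc a) (fsuc b) = refl

  -- Every matrix reduces to a partial trace: if it is nonzero, move a nonzero
  -- entry to the corner, scale it to 1, clear its row and column, and reduce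
  -- the remaining block.
  reduce : ∀ {ℓ m} (G : Matrix ℓ m) → Reduction G
  reduce {zero}  {m}     G = Reduction-zero λ ()
  reduce {suc ℓ} {zero}  G = Reduction-zero λ a ()
  reduce {suc ℓ} {suc m} G with any? (λ a → any? (λ b → ¬? (G a b ≟ 0#)))
  ... | no none = Reduction-zero λ a b → decidable-stable (G a b ≟ 0#) λ Gab≢0 → none (a , b , Gab≢0)
  ... | yes (a , b , Gab≢0) =
    let os₁ , corner≢0 = pivot-to-corner G a b Gab≢0
        G₁             = actAll os₁ G
        os₂ , corner≡1 = normalize-corner G₁ corner≢0
        G₂             = actAll os₂ G₁
        os₃ , H , G₂↦H = clear-corner G₂ corner≡1
    in  Reduction-after os₁ (λ _ _ → refl) (Reduction-after os₂ (λ _ _ → refl)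
          (Reduction-after os₃ G₂↦H (Reduction-block (reduce H))))

  adjointAll : ∀ {ℓ m} → List (MatOp ℓ m) → Matrix ℓ m → Matrix ℓ m
  adjointAll []       N = N
  adjointAll (o ∷ os) N = act (adjointMatOp o) (adjointAll os N)

  pair-actAll : ∀ {ℓ m} (os : List (MatOp ℓ m)) (G N : Matrix ℓ m) → pair (actAll os G) N ≡ pair G (adjointAll os N)
  pair-actAll []       G N = refl
  pair-actAll (o ∷ os) G N = trans (pair-actAll os (act o G) N) (act-adjoint o G (adjointAll os N))

  adjointAll⁻¹ : ∀ {ℓ m} → List (MatOp ℓ m) → Matrix ℓ m → Matrix ℓ m
  adjointAll⁻¹ []       N = N
  adjointAll⁻¹ (o ∷ os) N = adjointAll⁻¹ os (act (inverseMatOp (adjointMatOp o)) N)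

  adjointAll-inverse : ∀ {ℓ m} (os : List (MatOp ℓ m)) (N : Matrix ℓ m) → adjointAll os (adjointAll⁻¹ os N) ≐ N
  adjointAll-inverse []       N = λ _ _ → refl
  adjointAll-inverse (o ∷ os) N a b =
    trans (act-cong (adjointMatOp o) (adjointAll-inverse os _) a b) (act-inverseʳ (adjointMatOp o) N a b)

  -- The properties of a map on matrices that make it preserve Hamming weights:
  -- it is well defined, commutes with scalars, preserves rank and is injective.
  record RankPreserving {ℓ m} (φ : Matrix ℓ m → Matrix ℓ m) : Set where
    field
      resp-≐         : ∀ {G H} → G ≐ H → φ G ≐ φ H
      homogeneous    : ∀ c G → φ (λ a b → c * G a b) ≐ (λ a b → c * φ G a b)
      preserves-rank : ∀ {G r} → Rank G r → Rank (φ G) r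
      injective      : ∀ {G H} → φ G ≐ φ H → G ≐ H

  id-rankPreserving : ∀ {ℓ m} → RankPreserving {ℓ} {m} (λ G → G)
  id-rankPreserving = record
    { resp-≐ = λ G≐H → G≐H ; homogeneous = λ _ _ _ _ → refl ; preserves-rank = λ rk → rk ; injective = λ G≐H → G≐H }

  ∘-rankPreserving : ∀ {ℓ m} {φ ψ : Matrix ℓ m → Matrix ℓ m} →
                     RankPreserving φ → RankPreserving ψ → RankPreserving (λ G → φ (ψ G))
  ∘-rankPreserving {ψ = ψ} φ-rp ψ-rp = record
    { resp-≐         = Φ.resp-≐ ∘ Ψ.resp-≐
    ; homogeneous    = λ c G a b → trans (Φ.resp-≐ (Ψ.homogeneous c G) a b) (Φ.homogeneous c (ψ G) a b)
    ; preserves-rank = Φ.preserves-rank ∘ Ψ.preserves-rank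
    ; injective      = Ψ.injective ∘ Φ.injective
    }
    where
      module Φ = RankPreserving φ-rp
      module Ψ = RankPreserving ψ-rp

  act-rankPreserving : ∀ {ℓ m} (o : MatOp ℓ m) → RankPreserving (act o)
  act-rankPreserving o = record
    { resp-≐         = act-cong o
    ; homogeneous    = act-scalar o
    ; preserves-rank = Rank-act o _
    ; injective      = λ {G} {H} oG≐oH a b →
        trans (sym (act-inverseˡ o G a b)) (trans (act-cong (inverseMatOp o) oG≐oH a b) (act-inverseˡ o H a b))
    }

  adjointAll-rankPreserving : ∀ {ℓ m} (os : List (MatOp ℓ m)) → RankPreserving (adjointAll os)
  adjointAll-rankPreserving []       = id-rankPreserving
  adjointAll-rankPreserving (o ∷ os) =
    ∘-rankPreserving (act-rankPreserving (adjointMatOp o)) (adjointAll-rankPreserving os)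

  adjointAll⁻¹-rankPreserving : ∀ {ℓ m} (os : List (MatOp ℓ m)) → RankPreserving (adjointAll⁻¹ os)
  adjointAll⁻¹-rankPreserving []       = id-rankPreserving
  adjointAll⁻¹-rankPreserving (o ∷ os) =
    ∘-rankPreserving (adjointAll⁻¹-rankPreserving os) (act-rankPreserving (inverseMatOp (adjointMatOp o)))

  Transfers : ∀ {ℓ m} → Matrix ℓ m → Matrix ℓ m → Set
  Transfers A B = ∃ λ φ → RankPreserving φ × (∀ N → pair A (φ N) ≡ pair B N)

  -- A form of rank r and the partial trace τ_r transfer to each other: reduce
  -- F to τ_r' by operations os, note r' = r by rank invariance, and use the
  -- adjoint of os and its right inverse.
  transfers-τ : ∀ {ℓ m r} (F : Matrix ℓ m) → Rank F r → Transfers F (τ r) × Transfers (τ r) F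
  transfers-τ F rk-F with reduce F
  ... | os , r′ , r′≤ℓ , r′≤m , F↦τr′
    with rank-unique (τ r′) (Rank-τ r′ r′≤ℓ r′≤m) (Rank-resp F↦τr′ (Rank-actAll os F rk-F))
  ... | refl = (adjointAll os , adjointAll-rankPreserving os , forward) ,
               (adjointAll⁻¹ os , adjointAll⁻¹-rankPreserving os , backward)
    where
      forward : ∀ N → pair F (adjointAll os N) ≡ pair (τ r′) N
      forward N = trans (sym (pair-actAll os F N)) (pair-cong F↦τr′ (λ _ _ → refl))
      backward : ∀ N → pair (τ r′) (adjointAll⁻¹ os N) ≡ pair F N
      backward N = begin
        pair (τ r′) (adjointAll⁻¹ os N)             ≡⟨ pair-cong (λ a b → sym (F↦τr′ a b)) (λ _ _ → refl) ⟩
        pair (actAll os F) (adjointAll⁻¹ os N)      ≡⟨ pair-actAll os F _ ⟩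
        pair F (adjointAll os (adjointAll⁻¹ os N))  ≡⟨ pair-cong (λ _ _ → refl) (adjointAll-inverse os N) ⟩
        pair F N                                    ∎

  infixr 7 _·_
  _·_ : ∀ {ℓ m} → Carrier → Mat K ℓ m → Mat K ℓ m
  c · M = _·ₘ_ K c M

  mat-ext : ∀ {ℓ m} (M N : Mat K ℓ m) → entry K M ≐ entry K N → M ≡ N
  mat-ext M N M≐N = vec-ext M N (λ a → vec-ext _ _ (M≐N a))

  entry-scale : ∀ {ℓ m} c (M : Mat K ℓ m) → entry K (c · M) ≐ (λ a b → c * entry K M a b)
  entry-scale c M a b =
    trans (cong (λ v → lookup v b) (Vecₚ.lookup-map a (_·ᵥ_ K c) M)) (Vecₚ.lookup-map b (c *_) (lookup M a))

  entry-zero : ∀ {ℓ m} → entry K (zeroMat K {ℓ} {m}) ≐ (λ _ _ → 0#)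
  entry-zero a b =
    trans (cong (λ v → lookup v b) (Vecₚ.lookup-replicate a (zeroVec K))) (Vecₚ.lookup-replicate b 0#)

  sumK≡sum : ∀ {n} (v : Vec Carrier n) → sumK K v ≡ sum (lookup v)
  sumK≡sum []      = refl
  sumK≡sum (x ∷ v) = cong (x +_) (sumK≡sum v)

  evalLin≡pair : ∀ {ℓ m} (A M : Mat K ℓ m) → evalLin K A M ≡ pair (entry K A) (entry K M)
  evalLin≡pair A M = trans (sumK≡sum (Vec.zipWith (λ u v → sumK K (Vec.zipWith _*_ u v)) A M))
    (sum-cong-≗ λ a → trans (Vecₚ.lookup-zipWith _ a A M)
      (trans (sumK≡sum (Vec.zipWith _*_ (lookup A a) (lookup M a)))
             (sum-cong-≗ λ b → Vecₚ.lookup-zipWith _*_ b (lookup A a) (lookup M a))))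

  ·-assoc : ∀ {ℓ m} c d (M : Mat K ℓ m) → c · d · M ≡ (c * d) · M
  ·-assoc c d M = mat-ext _ _ λ a b → begin
    entry K (c · d · M) a b     ≡⟨ entry-scale c (d · M) a b ⟩
    c * entry K (d · M) a b     ≡⟨ cong (c *_) (entry-scale d M a b) ⟩
    c * (d * entry K M a b)     ≡⟨ sym (*-assoc c d _) ⟩
    (c * d) * entry K M a b     ≡⟨ sym (entry-scale (c * d) M a b) ⟩
    entry K ((c * d) · M) a b   ∎

  ·-identity : ∀ {ℓ m} (M : Mat K ℓ m) → 1# · M ≡ M
  ·-identity M = mat-ext _ _ λ a b → trans (entry-scale 1# M a b) (*-identityˡ _)

  ·-zero : ∀ {ℓ m} (M : Mat K ℓ m) → 0# · M ≡ zeroMat K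
  ·-zero M = mat-ext _ _ λ a b → trans (entry-scale 0# M a b) (trans (zeroˡ _) (sym (entry-zero a b)))

  evalLin-scale : ∀ {ℓ m} (A M : Mat K ℓ m) c → evalLin K A (c · M) ≡ c * evalLin K A M
  evalLin-scale A M c = begin
    evalLin K A (c · M)
      ≡⟨ evalLin≡pair A _ ⟩
    pair (entry K A) (entry K (c · M))
      ≡⟨ pair-cong (λ _ _ → refl) (entry-scale c M) ⟩
    sum (λ a → sum (λ b → entry K A a b * (c * entry K M a b)))
      ≡⟨ sum-cong-≗ (λ a → trans (sum-cong-≗ λ b → x∙yz≈y∙xz (entry K A a b) c (entry K M a b))
                                 (sym (*-distribˡ-sum c (λ b → entry K A a b * entry K M a b)))) ⟩
    sum (λ a → c * dot (entry K A a) (entry K M a))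
      ≡⟨ sym (*-distribˡ-sum c (λ a → dot (entry K A a) (entry K M a))) ⟩
    c * pair (entry K A) (entry K M)
      ≡⟨ cong (c *_) (sym (evalLin≡pair A M)) ⟩
    c * evalLin K A M ∎

  scalar≢0 : ∀ {ℓ m} {y M : Mat K ℓ m} {c} → y ≢ zeroMat K → y ≡ c · M → c ≢ 0#
  scalar≢0 {M = M} y≢0 y≡cM c≡0 = y≢0 (trans y≡cM (trans (cong (_· M) c≡0) (·-zero M)))

  unscale : ∀ {ℓ m} {y M : Mat K ℓ m} {c} (c≢0 : c ≢ 0#) → y ≡ c · M → M ≡ inv c c≢0 · y
  unscale {y = y} {M} {c} c≢0 y≡cM = begin
    M                       ≡⟨ sym (·-identity M) ⟩
    1# · M                  ≡⟨ cong (_· M) (sym (inv-l c c≢0)) ⟩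
    (inv c c≢0 * c) · M     ≡⟨ sym (·-assoc _ _ M) ⟩
    inv c c≢0 · c · M       ≡⟨ cong (inv c c≢0 ·_) (sym y≡cM) ⟩
    inv c c≢0 · y           ∎

  -- Counting: if the form A transfers to the form B along φ, then the
  -- corresponding map χ on matrices sends the support of B injectively into
  -- the support of A, both among all matrices of rank ≤ t and among the
  -- classes of scalar multiples; hence weight B ≤ weight A.
  module Counting {ℓ m} (A B : Mat K ℓ m) (transfer : Transfers (entry K A) (entry K B)) where
    φ : Matrix ℓ m → Matrix ℓ m
    φ = proj₁ transfer
    open RankPreserving (proj₁ (proj₂ transfer))

    χ : Mat K ℓ m → Mat K ℓ m
    χ M = toMat (φ (entry K M))

    χ-injective : ∀ {M N} → χ M ≡ χ N → M ≡ N
    χ-injective {M} {N} χM≡χN = mat-ext M N (injective λ a b →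
      trans (sym (entry-toMat _ a b)) (trans (cong (λ X → entry K X a b) χM≡χN) (entry-toMat _ a b)))

    χ-scale : ∀ c M → χ (c · M) ≡ c · χ M
    χ-scale c M = mat-ext _ _ λ a b → begin
      entry K (χ (c · M)) a b            ≡⟨ entry-toMat _ a b ⟩
      φ (entry K (c · M)) a b            ≡⟨ resp-≐ (entry-scale c M) a b ⟩
      φ (λ a b → c * entry K M a b) a b  ≡⟨ homogeneous c (entry K M) a b ⟩
      c * φ (entry K M) a b              ≡⟨ cong (c *_) (sym (entry-toMat _ a b)) ⟩
      c * entry K (χ M) a b              ≡⟨ sym (entry-scale c (χ M) a b) ⟩
      entry K (c · χ M) a b              ∎

    χ≢0 : ∀ {M} → M ≢ zeroMat K → χ M ≢ zeroMat K
    χ≢0 {M} M≢0 χM≡0 = M≢0 (χ-injective (begin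
      χ M                    ≡⟨ χM≡0 ⟩
      zeroMat K              ≡⟨ sym (·-zero (χ (zeroMat K))) ⟩
      0# · χ (zeroMat K)     ≡⟨ sym (χ-scale 0# (zeroMat K)) ⟩
      χ (0# · zeroMat K)     ≡⟨ cong χ (·-zero (zeroMat K)) ⟩
      χ (zeroMat K)          ∎))

    χ-rank : ∀ {t} M → RankLE K M t → RankLE K (χ M) t
    χ-rank M (r , rk , r≤t) =
      r , Rank⇒HasRank (χ M) r (Rank-resp (λ a b → sym (entry-toMat _ a b)) (preserves-rank (HasRank⇒Rank M r rk))) ,
      r≤t

    evalLin-χ : ∀ N → evalLin K A (χ N) ≡ evalLin K B N
    evalLin-χ N = begin
      evalLin K A (χ N)                 ≡⟨ evalLin≡pair A (χ N) ⟩
      pair (entry K A) (entry K (χ N))  ≡⟨ pair-cong (λ _ _ → refl) (entry-toMat (φ (entry K N))) ⟩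
      pair (entry K A) (φ (entry K N))  ≡⟨ proj₂ (proj₂ transfer) (entry K N) ⟩
      pair (entry K B) (entry K N)      ≡⟨ sym (evalLin≡pair B N) ⟩
      evalLin K B N                     ∎

    supportA : (M : Mat K ℓ m) → Dec (evalLin K A M ≢ 0#)
    supportA M = ¬? (evalLin K A M ≟ 0#)
    supportB : (M : Mat K ℓ m) → Dec (evalLin K B M ≢ 0#)
    supportB M = ¬? (evalLin K B M ≟ 0#)

    weight-≤ : ∀ t (Ms : List (Mat K ℓ m)) → IsRankEnum K t Ms → weight K B Ms ≤ weight K A Ms
    weight-≤ t Ms (unique , rank≤t , complete) =
      length-≤-by-relation (λ x y → y ≡ χ x) _≡_ (λ y≡χx y≡χx′ → χ-injective (trans (sym y≡χx) y≡χx′))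
        (filter supportB Ms) (filter supportA Ms) (AllPairsₚ.filter⁺ supportB unique) related
      where
        related : ∀ {x} → x ∈ filter supportB Ms → ∃ λ y → y ∈ filter supportA Ms × y ≡ χ x
        related {x} x∈ =
          let x∈Ms , Bx≢0 = ∈-filter⁻ supportB x∈
          in  χ x , ∈-filter⁺ supportA (complete (χ x) (χ-rank x (All.lookup rank≤t x∈Ms)))
                                       (Bx≢0 ∘ trans (sym (evalLin-χ x))) ,
              refl

    -- For the classes of scalar multiples, x corresponds to the representative
    -- y of the class of χ x.
    Represents : Mat K ℓ m → Mat K ℓ m → Set
    Represents x y = y ≢ zeroMat K × ScalarMultiple K y (χ x)

    represents-same-class : ∀ {x x′ y} → Represents x y → Represents x′ y → ScalarMultiple K x x′
    represents-same-class {x} {x′} {y} (y≢0 , c , y≡cχx) (_ , c′ , y≡c′χx′) =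
      inv c c≢0 * c′ , χ-injective (begin
        χ x                         ≡⟨ unscale c≢0 y≡cχx ⟩
        inv c c≢0 · y               ≡⟨ cong (inv c c≢0 ·_) y≡c′χx′ ⟩
        inv c c≢0 · c′ · χ x′       ≡⟨ ·-assoc _ _ _ ⟩
        (inv c c≢0 * c′) · χ x′     ≡⟨ sym (χ-scale _ x′) ⟩
        χ ((inv c c≢0 * c′) · x′)   ∎)
      where c≢0 = scalar≢0 y≢0 y≡cχx

    represents-support : ∀ {x y} → evalLin K B x ≢ 0# → Represents x y → evalLin K A y ≢ 0#
    represents-support {x} {y} Bx≢0 (y≢0 , c , y≡cχx) Ay≡0 = *≢0 c _ (scalar≢0 y≢0 y≡cχx) Bx≢0 (begin
      c * evalLin K B x         ≡⟨ cong (c *_) (sym (evalLin-χ x)) ⟩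
      c * evalLin K A (χ x)     ≡⟨ sym (evalLin-scale A (χ x) c) ⟩
      evalLin K A (c · χ x)     ≡⟨ cong (evalLin K A) (sym y≡cχx) ⟩
      evalLin K A y             ≡⟨ Ay≡0 ⟩
      0#                        ∎)

    weight-≤-proj : ∀ t (Ms : List (Mat K ℓ m)) → IsProjRankEnum K t Ms → weight K B Ms ≤ weight K A Ms
    weight-≤-proj t Ms (nonzero-rank≤t , inequivalent , complete) =
      length-≤-by-relation Represents (ScalarMultiple K) represents-same-class
        (filter supportB Ms) (filter supportA Ms) (AllPairsₚ.filter⁺ supportB inequivalent) related
      where
        related : ∀ {x} → x ∈ filter supportB Ms → ∃ λ y → y ∈ filter supportA Ms × Represents x y
        related {x} x∈ with ∈-filter⁻ supportB x∈
        ... | x∈Ms , Bx≢0 with All.lookup nonzero-rank≤t x∈Ms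
        ... | x≢0 , x-rank≤t with complete (χ x) (χ≢0 x≢0) (χ-rank x x-rank≤t)
        ... | y , y∈Ms , c , χx≡cy = y , ∈-filter⁺ supportA y∈Ms (represents-support Bx≢0 x↦y) , x↦y
          where
            c≢0 = scalar≢0 (χ≢0 x≢0) χx≡cy
            x↦y : Represents x y
            x↦y = proj₁ (All.lookup nonzero-rank≤t y∈Ms) , inv c c≢0 , unscale c≢0 χx≡cy

-- The theorem: each weight bounds the other, in both codes, because F and
-- τ_r transfer to each other.
lemma3p1 : (K : FiniteField) (t ℓ m : ℕ) → 1 ≤ t → t ≤ ℓ → ℓ ≤ m →
    (F : Mat K ℓ m) (r : ℕ) → HasRank K F r →
    (∀ (Ms : List (Mat K ℓ m)) → IsRankEnum K t Ms →
      weight K F Ms ≡ weight K (partialTrace K r) Ms)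
    × (∀ (Ms : List (Mat K ℓ m)) → IsProjRankEnum K t Ms →
      weight K F Ms ≡ weight K (partialTrace K r) Ms)
lemma3p1 K t ℓ m _ _ _ F r rk-F =
  (λ Ms enum → ℕₚ.≤-antisym (τ→F.weight-≤ t Ms enum) (F→τ.weight-≤ t Ms enum)) ,
  (λ Ms enum → ℕₚ.≤-antisym (τ→F.weight-≤-proj t Ms enum) (F→τ.weight-≤-proj t Ms enum))
  where
    T = partialTrace K r
    transfers = transfers-τ K (entry K F) (HasRank⇒Rank K F r rk-F)
    module F→τ = Counting K F T (proj₁ transfers)
    module τ→F = Counting K T F (proj₂ transfers)
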